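{- For a mixed graph $G$ with $n$ vertices, let $\ell(G)$ be the number of bijections $c:V(G)\to\{1,\dots,n\}$ such that $c(x)<c(y)$ whenever $(x,y)\in A(G)$, and put $\lambda_0(G)=\ell(G)/|V(G)|!$ and $\phi_0(G)=\lambda_0(G)X^{|V(G)|}$, extended linearly to $\mathcal{F}[\mathbf{G}]$. Then $\lambda_0$ is a character of $\mathcal{F}[\mathbf{G}]$ (an algebra morphism $\mathcal{F}[\mathbf{G}]\to\mathbb{K}$), and $\phi_0:(\mathcal{F}[\mathbf{G}],m,\Delta)\to(\mathbb{K}[X],m,\Delta)$ is a bialgebra morphism.
   Context: A mixed graph $G$ has a finite vertex set $V(G)$, edges $E(G)$ (2-element subsets) and arcs $A(G)$ (ordered pairs of distinct vertices), no pair being both an edge and carrying an arc. $\mathcal{F}[\mathbf{G}]$: vector space over a field $\mathbb{K}$ of characteristic $0$ with basis the isomorphism classes of mixed graphs; product $m$ = disjoint union; $\Delta(G)=\sum_{I\text{ ideal}}G_{\mid V(G)\setminus I}\otimes G_{\mid I}$, where $I$ is an ideal if $x\in I$, $(x,y)\in A(G)$ imply $y\in I$ and $G_{\mid I}$ is the induced mixed graph. $\mathbb{K}[X]$ has its usual product and $\Delta(X)=X\otimes1+1\otimes X$. For the empty graph, $\ell=1$. -}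

module Defs where

open import Level using (Level; _⊔_) renaming (suc to lsuc)
open import Data.Nat as ℕ using (ℕ; zero; suc; _∸_; _!; _≡ᵇ_; ≢-nonZero⁻¹)
open import Data.Nat.Properties using (_!≢0)
open import Data.Nat.Combinatorics using (_C_)
open import Data.Bool using (Bool; true; false; not; if_then_else_; _∧_)
open import Data.Bool.Properties using () renaming (_≟_ to _≟ᵇ_)
open import Data.Fin as Fin using (Fin; zero; suc; splitAt; _<_)
open import Data.Fin.Properties using (all?; any?; _<?_) renaming (_≟_ to _≟ᶠ_)
open import Data.Vec using (Vec; []; _∷_; lookup) renaming (map to vmap)
open import Data.List using (List; []; _∷_; [_]; map; concatMap; filter; length; foldr; allFin)
open import Data.Product using (Σ; ∃; _×_; _,_; proj₁; proj₂)
open import Data.Sum using (_⊎_; inj₁; inj₂)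
open import Relation.Nullary using (¬_; Dec; _×-dec_; _→-dec_)
open import Relation.Binary.PropositionalEquality using (_≡_; refl; sym; trans; cong)
open import Function.Bundles using (_↔_; Inverse)
open import Algebra.Bundles using (CommutativeRing)

record MixedGraph : Set where
  field
    n     : ℕ
    E     : Fin n → Fin n → Bool      -- E x y = true : {x,y} is an edge
    A     : Fin n → Fin n → Bool      -- A x y = true : (x,y) is an arc
    E-sym : ∀ x y → E x y ≡ E y x
    E-irr : ∀ x → E x x ≡ false        -- edges are 2-element subsets
    A-irr : ∀ x → A x x ≡ false
    EA-disj : ∀ x y → E x y ≡ true → A x y ≡ false

open MixedGraph public

_≅_ : MixedGraph → MixedGraph → Set
G ≅ H = Σ (Fin (n G) ↔ Fin (n H)) λ σ →
          ∀ x y → (E G x y ≡ E H (Inverse.to σ x) (Inverse.to σ y))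
                × (A G x y ≡ A H (Inverse.to σ x) (Inverse.to σ y))

∅G : MixedGraph
∅G = record { n = 0 ; E = λ () ; A = λ () ; E-sym = λ () ; E-irr = λ ()
            ; A-irr = λ () ; EA-disj = λ () }

module _ {p q : ℕ} where
  comb : (Fin p → Fin p → Bool) → (Fin q → Fin q → Bool)
       → Fin p ⊎ Fin q → Fin p ⊎ Fin q → Bool
  comb R S (inj₁ a) (inj₁ b) = R a b
  comb R S (inj₂ a) (inj₂ b) = S a b
  comb R S (inj₁ a) (inj₂ b) = false
  comb R S (inj₂ a) (inj₁ b) = false

  comb-sym : ∀ {R S} → (∀ x y → R x y ≡ R y x) → (∀ x y → S x y ≡ S y x)
           → ∀ u v → comb R S u v ≡ comb R S v u
  comb-sym hR hS (inj₁ a) (inj₁ b) = hR a b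
  comb-sym hR hS (inj₂ a) (inj₂ b) = hS a b
  comb-sym hR hS (inj₁ a) (inj₂ b) = refl
  comb-sym hR hS (inj₂ a) (inj₁ b) = refl

  comb-irr : ∀ {R S} → (∀ x → R x x ≡ false) → (∀ x → S x x ≡ false)
           → ∀ u → comb R S u u ≡ false
  comb-irr hR hS (inj₁ a) = hR a
  comb-irr hR hS (inj₂ a) = hS a

  comb-disj : ∀ {R S R′ S′} → (∀ x y → R x y ≡ true → R′ x y ≡ false)
            → (∀ x y → S x y ≡ true → S′ x y ≡ false)
            → ∀ u v → comb R S u v ≡ true → comb R′ S′ u v ≡ false
  comb-disj hR hS (inj₁ a) (inj₁ b) e = hR a b e
  comb-disj hR hS (inj₂ a) (inj₂ b) e = hS a b e
  comb-disj hR hS (inj₁ a) (inj₂ b) e = refl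
  comb-disj hR hS (inj₂ a) (inj₁ b) e = refl

_⊔G_ : MixedGraph → MixedGraph → MixedGraph
G ⊔G H = record
  { n = n G ℕ.+ n H
  ; E = λ x y → comb (E G) (E H) (sp x) (sp y)
  ; A = λ x y → comb (A G) (A H) (sp x) (sp y)
  ; E-sym = λ x y → comb-sym (E-sym G) (E-sym H) (sp x) (sp y)
  ; E-irr = λ x → comb-irr (E-irr G) (E-irr H) (sp x)
  ; A-irr = λ x → comb-irr (A-irr G) (A-irr H) (sp x)
  ; EA-disj = λ x y → comb-disj (EA-disj G) (EA-disj H) (sp x) (sp y)
  }
  where sp = splitAt (n G)

-- subsets of Fin n as characteristic vectors, and induced subgraphs
size : ∀ {k} → Vec Bool k → ℕ
size []          = 0
size (true ∷ p)  = suc (size p)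
size (false ∷ p) = size p

-- the increasing enumeration of the elements of a subset
select : ∀ {k} (p : Vec Bool k) → Fin (size p) → Fin k
select (true ∷ p)  zero    = zero
select (true ∷ p)  (suc i) = suc (select p i)
select (false ∷ p) i       = suc (select p i)

_∣_ : (G : MixedGraph) → Vec Bool (n G) → MixedGraph
G ∣ I = record
  { n = size I
  ; E = λ x y → E G (s x) (s y)
  ; A = λ x y → A G (s x) (s y)
  ; E-sym = λ x y → E-sym G (s x) (s y)
  ; E-irr = λ x → E-irr G (s x)
  ; A-irr = λ x → A-irr G (s x)
  ; EA-disj = λ x y → EA-disj G (s x) (s y)
  }
  where s = select I

_∖_ : (G : MixedGraph) → Vec Bool (n G) → MixedGraph
G ∖ I = G ∣ vmap not I

IsIdeal : (G : MixedGraph) → Vec Bool (n G) → Set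
IsIdeal G I = ∀ x y → lookup I x ≡ true → A G x y ≡ true → lookup I y ≡ true

isIdeal? : (G : MixedGraph) (I : Vec Bool (n G)) → Dec (IsIdeal G I)
isIdeal? G I = all? λ x → all? λ y →
  (lookup I x ≟ᵇ true) →-dec (A G x y ≟ᵇ true) →-dec (lookup I y ≟ᵇ true)

allVecs : ∀ {a} {X : Set a} → List X → (k : ℕ) → List (Vec X k)
allVecs xs zero    = [ [] ]
allVecs xs (suc k) = concatMap (λ x → map (x ∷_) (allVecs xs k)) xs

ideals : (G : MixedGraph) → List (Vec Bool (n G))
ideals G = filter (isIdeal? G) (allVecs (true ∷ false ∷ []) (n G))

IsLinExt : (G : MixedGraph) → (Fin (n G) → Fin (n G)) → Set
IsLinExt G c = (∀ x y → c x ≡ c y → x ≡ y)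
             × (∀ y → ∃ λ x → c x ≡ y)
             × (∀ x y → A G x y ≡ true → c x < c y)

isLinExt? : (G : MixedGraph) (c : Fin (n G) → Fin (n G)) → Dec (IsLinExt G c)
isLinExt? G c =
  (all? λ x → all? λ y → (c x ≟ᶠ c y) →-dec (x ≟ᶠ y))
  ×-dec (all? λ y → any? λ x → c x ≟ᶠ y)
  ×-dec (all? λ x → all? λ y → (A G x y ≟ᵇ true) →-dec (c x <? c y))

-- ℓ(G): the number of such bijections (each function is listed once
-- as the vector of its values)
ℓG : MixedGraph → ℕ
ℓG G = length (filter (λ v → isLinExt? G (lookup v))
                      (allVecs (allFin (n G)) (n G)))

module _ {c ℓ} (R : CommutativeRing c ℓ) where
  open CommutativeRing R
  ι : ℕ → Carrier
  ι zero    = 0#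
  ι (suc k) = 1# + ι k

record CharZeroField (c ℓ : Level) : Set (lsuc (c ⊔ ℓ)) where
  field
    cring : CommutativeRing c ℓ
  open CommutativeRing cring
  field
    0≉1   : ¬ (0# ≈ 1#)
    inv   : (x : Carrier) → ¬ (x ≈ 0#) → Carrier
    inv-r : ∀ x (p : ¬ (x ≈ 0#)) → x * inv x p ≈ 1#
    char0 : ∀ k → ι cring k ≈ 0# → k ≡ 0

module Over {c ℓ} (K : CharZeroField c ℓ) where
  open CharZeroField K
  open CommutativeRing cring public
  ιK = ι cring

  fact≉0 : ∀ k → ¬ (ιK (k !) ≈ 0#)
  fact≉0 k e = ≢-nonZero⁻¹ (k !) {{k !≢0}} (char0 (k !) e)

  λ₀ : MixedGraph → Carrier
  λ₀ G = ιK (ℓG G) * inv (ιK (n G !)) (fact≉0 (n G))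

  sumK : List Carrier → Carrier
  sumK = foldr _+_ 0#

  -- F[G]: finite formal K-linear combinations of mixed graphs
  -- (graphs standing for their isomorphism classes)
  FG : Set c
  FG = List (Carrier × MixedGraph)

  FG⊗FG : Set c
  FG⊗FG = List (Carrier × MixedGraph × MixedGraph)

  1F : FG
  1F = [ (1# , ∅G) ]

  mF : FG⊗FG → FG
  mF = map λ { (a , G , H) → (a , G ⊔G H) }

  ΔF : FG → FG⊗FG
  ΔF = concatMap λ { (a , G) → map (λ I → (a , G ∖ I , G ∣ I)) (ideals G) }

  εF : FG → Carrier
  εF x = sumK (map (λ { (a , G) → if n G ≡ᵇ 0 then a else 0# }) x)

  λ₀F : FG → Carrier
  λ₀F x = sumK (map (λ { (a , G) → a * λ₀ G }) x)

  λ₀⊗λ₀ : FG⊗FG → Carrier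
  λ₀⊗λ₀ z = sumK (map (λ { (a , G , H) → a * (λ₀ G * λ₀ H) }) z)

  -- K[X] as coefficient sequences, K[X] ⊗ K[X] ≅ K[X,Y] as double sequences
  Poly : Set c
  Poly = ℕ → Carrier

  Poly² : Set c
  Poly² = ℕ → ℕ → Carrier

  _≈P_ : Poly → Poly → Set ℓ
  p ≈P q = ∀ k → p k ≈ q k

  _≈P²_ : Poly² → Poly² → Set ℓ
  r ≈P² s = ∀ i j → r i j ≈ s i j

  sumTo : ℕ → (ℕ → Carrier) → Carrier
  sumTo zero    f = f 0
  sumTo (suc k) f = sumTo k f + f (suc k)

  1P : Poly
  1P zero    = 1#
  1P (suc k) = 0#

  mP : Poly² → Poly
  mP r k = sumTo k (λ i → r i (k ∸ i))

  -- Δ(X^k) = Σ_i (k choose i) X^i ⊗ X^(k-i)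
  ΔP : Poly → Poly²
  ΔP p i j = ιK ((i ℕ.+ j) C i) * p (i ℕ.+ j)

  εP : Poly → Carrier
  εP p = p 0

  φ₀ : FG → Poly
  φ₀ x k = sumK (map (λ { (a , G) → if n G ≡ᵇ k then a * λ₀ G else 0# }) x)

  φ₀⊗φ₀ : FG⊗FG → Poly²
  φ₀⊗φ₀ z i j = sumK (map (λ { (a , G , H) →
      if (n G ≡ᵇ i) ∧ (n H ≡ᵇ j) then a * (λ₀ G * λ₀ H) else 0# }) z)

-- Counting the linear extensions of an arc relation by their first vertex gives the recursion
-- ℓ(A) = Σ_{v source} ℓ(A − v).  It shows that ℓ is invariant under relabelling, that
-- ℓ(G ⊔ H) = C(n+m, n) ℓ(G) ℓ(H) (the first vertex comes from G or from H, and Pascal's rule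
-- closes the induction), and that Σ_{I ideal, |I| = j} ℓ(G ∖ I) ℓ(G ∣ I) = ℓ(G) for j ≤ n (the
-- first vertex outside an ideal is a source of G, and deleting it gives the same sum for G − v).
-- Dividing by factorials, λ₀ is multiplicative, and the ideal sums of λ₀(G ∖ I) λ₀(G ∣ I) are
-- C(i+j, i) λ₀(G), which is compatibility of φ₀ with Δ(X^k) = Σ_i C(k, i) X^i ⊗ X^(k−i).

module Submission where

open import Defs

module Counting where

  open import Data.Nat as ℕ using (ℕ; zero; suc; _+_; _*_; _∸_; _≤_; _<_; _!; _≡ᵇ_; z≤n; s≤s)
  import Data.Nat.Properties as ℕP
  open import Data.Nat.Combinatorics using (_C_; nCn≡1; nCk≡nC[n∸k]; nCk+nC[k+1]≡[n+1]C[k+1]; nCk≡n!/k![n-k]!; k![n∸k]!∣n!)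
  open import Data.Nat.DivMod using (m/n*n≡m)
  open import Data.Bool using (Bool; true; false; not; if_then_else_; _∧_)
  import Data.Bool.Properties as BP
  open import Data.Fin as Fin using (Fin; zero; suc; punchIn; punchOut; splitAt; join; _↑ˡ_; _↑ʳ_)
  import Data.Fin.Properties as FP
  open import Data.Fin.Permutation as Perm using (Permutation; _⟨$⟩ʳ_; _⟨$⟩ˡ_)
  open import Data.Vec as V using (Vec; []; _∷_; lookup; tabulate; _[_]≔_; insertAt)
  import Data.Vec.Properties as VP
  open import Data.List as List using (List; []; _∷_; filter; length; map; concatMap; allFin)
  import Data.List.Properties as LP
  open import Data.Nat.ListAction using () renaming (sum to listSum)
  open import Data.Nat.ListAction.Properties using () renaming (sum-++ to listSum-++)
  open import Data.List.Membership.Propositional using (_∈_)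
  import Data.List.Membership.Propositional.Properties as MP
  open import Data.List.Relation.Unary.Unique.Propositional using (Unique)
  import Data.List.Relation.Unary.Unique.Propositional.Properties as UP
  open import Data.List.Relation.Unary.Any as Any using (here)
  import Data.List.Relation.Unary.Any.Properties as AnyP
  open import Data.List.Relation.Unary.All as All using (_∷_)
  import Data.List.Relation.Unary.All.Properties as AllP
  open import Data.List.Relation.Unary.AllPairs as AP using (_∷_)
  import Data.List.Relation.Unary.AllPairs.Properties as APP
  open import Data.Product using (Σ; ∃; _×_; _,_; proj₁; proj₂)
  open import Data.Sum as Sum using (_⊎_; inj₁; inj₂)
  import Data.Sum.Properties as SumP
  open import Function.Construct.Composition using (_↔-∘_)
  open import Function.Construct.Symmetry using (↔-sym)
  open import Data.Empty using (⊥-elim)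
  open import Function using (_∘_)
  open import Function.Definitions using (Injective)
  open import Level using (_⊔_)
  open import Relation.Nullary using (¬_; Dec; yes; no; does; _×-dec_; _→-dec_)
  open import Relation.Nullary.Decidable using (dec-true; dec-false)
  open import Relation.Unary using (Pred; Decidable)
  open import Relation.Binary.PropositionalEquality
  import Algebra.Properties.Semiring.Sum as SemiringSum
  import Algebra.Properties.CommutativeSemigroup as CommSemigroupProps

  module Σℕ = SemiringSum ℕP.+-*-semiring
  open Σℕ using (sum)

  lookup-injective : ∀ {a} {X : Set a} {xs : List X} → Unique xs → ∀ i j →
                     List.lookup xs i ≡ List.lookup xs j → i ≡ j
  lookup-injective {xs = x ∷ xs} (_ ∷ u) zero    zero    e = refl
  lookup-injective {xs = x ∷ xs} (h ∷ u) zero    (suc j) e = ⊥-elim (All.lookup h (MP.∈-lookup j) e)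
  lookup-injective {xs = x ∷ xs} (h ∷ u) (suc i) zero    e = ⊥-elim (All.lookup h (MP.∈-lookup i) (sym e))
  lookup-injective {xs = x ∷ xs} (_ ∷ u) (suc i) (suc j) e = cong suc (lookup-injective u i j e)

  module _ {a b p q} {X : Set a} {Y : Set b} {P : Pred X p} {Q : Pred Y q}
           (P? : Decidable P) (Q? : Decidable Q) where

    count-≤-injection : ∀ {xs ys} → Unique xs → (∀ y → y ∈ ys) → (f : X → Y) →
                        (∀ x → P x → Q (f x)) → (∀ x y → P x → P y → f x ≡ f y → x ≡ y) →
                        length (filter P? xs) ≤ length (filter Q? ys)
    count-≤-injection {xs} {ys} u complete f pres inj = FP.injective⇒≤ F-injective
      where
      Ps : List X
      Ps = filter P? xs
      Qs : List Y
      Qs = filter Q? ys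
      P-lookup : ∀ i → P (List.lookup Ps i)
      P-lookup i = proj₂ (MP.∈-filter⁻ P? {xs = xs} (MP.∈-lookup i))
      image∈Qs : ∀ i → f (List.lookup Ps i) ∈ Qs
      image∈Qs i = MP.∈-filter⁺ Q? (complete _) (pres _ (P-lookup i))
      F : Fin (length Ps) → Fin (length Qs)
      F i = Any.index (image∈Qs i)
      F-injective : ∀ {i j} → F i ≡ F j → i ≡ j
      F-injective {i} {j} e = lookup-injective (UP.filter⁺ P? {xs} u) i j
        (inj _ _ (P-lookup i) (P-lookup j)
          (trans (AnyP.lookup-index (image∈Qs i))
            (trans (cong (List.lookup Qs) e) (sym (AnyP.lookup-index (image∈Qs j))))))

  count-none : ∀ {a p} {X : Set a} {P : Pred X p} (P? : Decidable P) xs → (∀ x → ¬ P x) →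
               length (filter P? xs) ≡ 0
  count-none P? xs none = cong length (LP.filter-none P? (All.universal none xs))

  indicator : Bool → ℕ
  indicator true  = 1
  indicator false = 0

  count≡sum-indicator : ∀ {a p} {X : Set a} {P : Pred X p} (P? : Decidable P) (xs : List X) →
                        length (filter P? xs) ≡ listSum (map (indicator ∘ does ∘ P?) xs)
  count≡sum-indicator P? [] = refl
  count≡sum-indicator P? (x ∷ xs) with does (P? x)
  ... | true  = cong suc (count≡sum-indicator P? xs)
  ... | false = count≡sum-indicator P? xs

  allVecs-complete : ∀ {a} {X : Set a} (xs : List X) → (∀ x → x ∈ xs) →
                     ∀ {k} (v : Vec X k) → v ∈ allVecs xs k
  allVecs-complete xs complete []      = here refl
  allVecs-complete xs complete (x ∷ v) =
    MP.∈-concatMap⁺ (λ z → map (z ∷_) (allVecs xs _))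
      (Any.map (λ { refl → MP.∈-map⁺ (x ∷_) (allVecs-complete xs complete v) }) (complete x))

  allVecs-unique : ∀ {a} {X : Set a} {xs : List X} → Unique xs → ∀ k → Unique (allVecs xs k)
  allVecs-unique u zero    = All.[] ∷ AP.[]
  allVecs-unique {xs = xs} u (suc k) =
    UP.concat⁺ (AllP.map⁺ (All.universal (λ x → UP.map⁺ VP.∷-injectiveʳ (allVecs-unique u k)) xs))
               (APP.map⁺ (AP.map disjoint u))
    where
    disjoint : ∀ {x y} → x ≢ y → ∀ {v} → ¬ (v ∈ map (x ∷_) (allVecs xs k) × v ∈ map (y ∷_) (allVecs xs k))
    disjoint {x} {y} x≢y (m₁ , m₂) with MP.∈-map⁻ (x ∷_) m₁ | MP.∈-map⁻ (y ∷_) m₂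
    ... | _ , _ , refl | _ , _ , e = x≢y (VP.∷-injectiveˡ e)

  sum-zero : ∀ {n} (g : Fin n → ℕ) → (∀ v → g v ≡ 0) → sum g ≡ 0
  sum-zero {n} g h = trans (Σℕ.sum-cong-≗ h) (Σℕ.sum-replicate-zero n)

  sum-delta : ∀ {n} (g : Fin n → ℕ) w → (∀ v → v ≢ w → g v ≡ 0) → sum g ≡ g w
  sum-delta {suc n} g zero h =
    trans (cong (g zero +_) (sum-zero (g ∘ suc) (λ v → h (suc v) (λ ())))) (ℕP.+-identityʳ _)
  sum-delta {suc n} g (suc w) h =
    trans (cong (_+ sum (g ∘ suc)) (h zero (λ ())))
          (sum-delta (g ∘ suc) w (λ v ne → h (suc v) (ne ∘ FP.suc-injective)))

  sum-split : ∀ n {m} (f : Fin (n + m) → ℕ) → sum f ≡ sum (f ∘ (_↑ˡ m)) + sum (f ∘ (n ↑ʳ_))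
  sum-split zero    f = refl
  sum-split (suc n) f = trans (cong (f zero +_) (sum-split n (f ∘ suc))) (sym (ℕP.+-assoc (f zero) _ _))

  listSum-sum-comm : ∀ {a} {X : Set a} {n} (g : X → Fin n → ℕ) (xs : List X) →
    listSum (map (sum ∘ g) xs) ≡ sum (λ v → listSum (map (λ x → g x v) xs))
  listSum-sum-comm {n = n} g []       = sym (Σℕ.sum-replicate-zero n)
  listSum-sum-comm         g (x ∷ xs) =
    trans (cong (sum (g x) +_) (listSum-sum-comm g xs)) (sym (Σℕ.∑-distrib-+ (g x) _))

  from-does-true : ∀ {p} {P : Set p} (d : Dec P) → does d ≡ true → P
  from-does-true (yes p) _ = p

  from-does-false : ∀ {p} {P : Set p} (d : Dec P) → does d ≡ false → ¬ P
  from-does-false (no ¬p) _ = ¬p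

  does-cong : ∀ {p q} {P : Set p} {Q : Set q} (P? : Dec P) (Q? : Dec Q) → (P → Q) → (Q → P) →
              does P? ≡ does Q?
  does-cong (yes _) (yes _)  _ _ = refl
  does-cong (yes p) (no ¬q)  f _ = ⊥-elim (¬q (f p))
  does-cong (no ¬p) (yes q)  _ g = ⊥-elim (¬p (g q))
  does-cong (no _)  (no _)   _ _ = refl

  false≢true : false ≢ true
  false≢true ()

  -- Linear extensions and the source recursion

  BoolRel : ℕ → Set
  BoolRel n = Fin n → Fin n → Bool

  IsLinearExtension : (n : ℕ) → BoolRel n → (Fin n → Fin n) → Set
  IsLinearExtension n A c = (∀ x y → c x ≡ c y → x ≡ y)
                          × (∀ y → ∃ λ x → c x ≡ y)
                          × (∀ x y → A x y ≡ true → c x Fin.< c y)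

  isLinearExtension? : (n : ℕ) (A : BoolRel n) (c : Fin n → Fin n) → Dec (IsLinearExtension n A c)
  isLinearExtension? n A c =
    (FP.all? λ x → FP.all? λ y → (c x FP.≟ c y) →-dec (x FP.≟ y))
    ×-dec (FP.all? λ y → FP.any? λ x → c x FP.≟ y)
    ×-dec (FP.all? λ x → FP.all? λ y → (A x y BP.≟ true) →-dec (c x FP.<? c y))

  -- ℓG G unfolds to #linExt (n G) (A G).
  #linExt : (n : ℕ) → BoolRel n → ℕ
  #linExt n A = length (filter (λ c → isLinearExtension? n A (lookup c)) (allVecs (allFin n) n))

  isSource : ∀ {n} → BoolRel n → Fin n → Bool
  isSource A v = does (FP.all? λ x → A x v BP.≟ false)

  removeVertex : ∀ {n} → Fin (suc n) → BoolRel (suc n) → BoolRel n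
  removeVertex v A x y = A (punchIn v x) (punchIn v y)

  orderings : (n : ℕ) → BoolRel n → ℕ
  sourceTerm : ∀ {n} → BoolRel (suc n) → Fin (suc n) → ℕ

  orderings zero    A = 1
  orderings (suc n) A = sum (sourceTerm A)

  sourceTerm {n} A v = if isSource A v then orderings n (removeVertex v A) else 0

  isSource-true : ∀ {n} (A : BoolRel n) v → isSource A v ≡ true → ∀ x → A x v ≡ false
  isSource-true A v = from-does-true (FP.all? λ x → A x v BP.≟ false)

  isSource-false : ∀ {n} (A : BoolRel n) v → isSource A v ≡ false → ∃ λ x → A x v ≡ true
  isSource-false {n} A v e with FP.¬∀⟶∃¬ n (λ x → A x v ≡ false) (λ x → A x v BP.≟ false)
                                   (from-does-false (FP.all? λ x → A x v BP.≟ false) e)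
  ... | x , h = x , BP.¬-not h

  IsLinearExtension-cong : ∀ {n A c c′} → (∀ x → c x ≡ c′ x) → IsLinearExtension n A c → IsLinearExtension n A c′
  IsLinearExtension-cong h (inj , surj , arcs) =
      (λ x y e → inj x y (trans (h x) (trans e (sym (h y)))))
    , (λ y → proj₁ (surj y) , trans (sym (h _)) (proj₂ (surj y)))
    , (λ x y a → subst₂ Fin._<_ (h x) (h y) (arcs x y a))

  punchIn-view : ∀ {n} (v y : Fin (suc n)) → y ≡ v ⊎ ∃ λ x → y ≡ punchIn v x
  punchIn-view v y with v FP.≟ y
  ... | yes e = inj₁ (sym e)
  ... | no ne = inj₂ (punchOut ne , sym (FP.punchIn-punchOut ne))

  -- The bijection behind #linExt-suc: linear extensions of A starting with v
  -- correspond to linear extensions of removeVertex v A.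
  predOr : ∀ {n} → Fin n → Fin (suc n) → Fin n
  predOr d zero    = d
  predOr d (suc i) = i

  suc-predOr : ∀ {n} (d : Fin n) (i : Fin (suc n)) → i ≢ zero → suc (predOr d i) ≡ i
  suc-predOr d zero    ne = ⊥-elim (ne refl)
  suc-predOr d (suc i) _  = refl

  restrictAfter : ∀ {n} → Fin (suc n) → (Fin (suc n) → Fin (suc n)) → Fin n → Fin n
  restrictAfter v c x = predOr x (c (punchIn v x))

  prependAt : ∀ {n} → Fin (suc n) → (Fin n → Fin n) → Fin (suc n) → Fin (suc n)
  prependAt v c y with v FP.≟ y
  ... | yes _ = zero
  ... | no ne = suc (c (punchOut ne))

  prependAt-self : ∀ {n} v (c : Fin n → Fin n) → prependAt v c v ≡ zero
  prependAt-self v c with v FP.≟ v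
  ... | yes _ = refl
  ... | no ne = ⊥-elim (ne refl)

  prependAt-punchIn : ∀ {n} v (c : Fin n → Fin n) x → prependAt v c (punchIn v x) ≡ suc (c x)
  prependAt-punchIn v c x with v FP.≟ punchIn v x
  ... | yes e = ⊥-elim (FP.punchInᵢ≢i v x (sym e))
  ... | no ne = cong (suc ∘ c) (trans (FP.punchOut-cong v refl) (FP.punchOut-punchIn v))

  module _ {n : ℕ} (A : BoolRel (suc n)) (v : Fin (suc n)) where

    suc-restrictAfter : ∀ c → (∀ x y → c x ≡ c y → x ≡ y) → c v ≡ zero →
                        ∀ x → suc (restrictAfter v c x) ≡ c (punchIn v x)
    suc-restrictAfter c inj cv≡0 x =
      suc-predOr x (c (punchIn v x)) (λ e → FP.punchInᵢ≢i v x (inj (punchIn v x) v (trans e (sym cv≡0))))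

    restrictAfter-linExt : ∀ c → IsLinearExtension (suc n) A c → c v ≡ zero →
                           IsLinearExtension n (removeVertex v A) (restrictAfter v c)
    restrictAfter-linExt c (inj , surj , arcs) cv≡0 = inj′ , surj′ , arcs′
      where
      shift : ∀ x → suc (restrictAfter v c x) ≡ c (punchIn v x)
      shift = suc-restrictAfter c inj cv≡0
      inj′ : ∀ x y → restrictAfter v c x ≡ restrictAfter v c y → x ≡ y
      inj′ x y e = FP.punchIn-injective v x y (inj _ _ (trans (sym (shift x)) (trans (cong suc e) (shift y))))
      surj′ : ∀ y → ∃ λ x → restrictAfter v c x ≡ y
      surj′ y with surj (suc y)
      ... | z , cz = punchOut v≢z , FP.suc-injective (trans (shift _) (trans (cong c (FP.punchIn-punchOut v≢z)) cz))
        where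
        v≢z : v ≢ z
        v≢z e = FP.0≢1+n (trans (sym cv≡0) (trans (cong c e) cz))
      arcs′ : ∀ x y → removeVertex v A x y ≡ true → restrictAfter v c x Fin.< restrictAfter v c y
      arcs′ x y a = ℕP.≤-pred (subst₂ Fin._<_ (sym (shift x)) (sym (shift y)) (arcs _ _ a))

    prependAt-linExt : ∀ c → IsLinearExtension n (removeVertex v A) c → (∀ x → A x v ≡ false) →
                       IsLinearExtension (suc n) A (prependAt v c)
    prependAt-linExt c (inj , surj , arcs) source = inj′ , surj′ , arcs′
      where
      0≢suc : ∀ x → prependAt v c v ≢ prependAt v c (punchIn v x)
      0≢suc x e = FP.0≢1+n (trans (sym (prependAt-self v c)) (trans e (prependAt-punchIn v c x)))
      inj′ : ∀ y₁ y₂ → prependAt v c y₁ ≡ prependAt v c y₂ → y₁ ≡ y₂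
      inj′ y₁ y₂ e with punchIn-view v y₁ | punchIn-view v y₂
      ... | inj₁ refl       | inj₁ refl        = refl
      ... | inj₁ refl       | inj₂ (x , refl)  = ⊥-elim (0≢suc x e)
      ... | inj₂ (x , refl) | inj₁ refl        = ⊥-elim (0≢suc x (sym e))
      ... | inj₂ (x , refl) | inj₂ (x′ , refl) =
        cong (punchIn v) (inj x x′ (FP.suc-injective
          (trans (sym (prependAt-punchIn v c x)) (trans e (prependAt-punchIn v c x′)))))
      surj′ : ∀ t → ∃ λ y → prependAt v c y ≡ t
      surj′ zero    = v , prependAt-self v c
      surj′ (suc t) with surj t
      ... | x , e = punchIn v x , trans (prependAt-punchIn v c x) (cong suc e)
      arcs′ : ∀ y₁ y₂ → A y₁ y₂ ≡ true → prependAt v c y₁ Fin.< prependAt v c y₂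
      arcs′ y₁ y₂ a with punchIn-view v y₁ | punchIn-view v y₂
      ... | _               | inj₁ refl        = ⊥-elim (false≢true (trans (sym (source y₁)) a))
      ... | inj₁ refl       | inj₂ (x , refl)  =
        subst₂ Fin._<_ (sym (prependAt-self v c)) (sym (prependAt-punchIn v c x)) (s≤s z≤n)
      ... | inj₂ (x , refl) | inj₂ (x′ , refl) =
        subst₂ Fin._<_ (sym (prependAt-punchIn v c x)) (sym (prependAt-punchIn v c x′)) (s≤s (arcs x x′ a))

  allMaps : (n : ℕ) → List (Vec (Fin n) n)
  allMaps n = allVecs (allFin n) n

  allMaps-unique : ∀ n → Unique (allMaps n)
  allMaps-unique n = allVecs-unique (UP.allFin⁺ n) n

  allMaps-complete : ∀ n (c : Vec (Fin n) n) → c ∈ allMaps n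
  allMaps-complete n = allVecs-complete (allFin n) MP.∈-allFin

  lookup-extensionality : ∀ {a} {X : Set a} {k} (u w : Vec X k) → (∀ i → lookup u i ≡ lookup w i) → u ≡ w
  lookup-extensionality u w h = trans (sym (VP.tabulate∘lookup u)) (trans (VP.tabulate-cong h) (VP.tabulate∘lookup w))

  module SourceRecursion {n : ℕ} (A : BoolRel (suc n)) where

    StartsAt : Fin (suc n) → Vec (Fin (suc n)) (suc n) → Set
    StartsAt v c = IsLinearExtension (suc n) A (lookup c) × lookup c v ≡ zero

    startsAt? : ∀ v → Decidable (StartsAt v)
    startsAt? v c = isLinearExtension? (suc n) A (lookup c) ×-dec (lookup c v FP.≟ zero)

    #startsAt : Fin (suc n) → ℕ
    #startsAt v = length (filter (startsAt? v) (allMaps (suc n)))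

    -- a linear extension puts exactly one vertex first
    indicator-linExt : ∀ c → indicator (does (isLinearExtension? (suc n) A (lookup c)))
                           ≡ sum (λ v → indicator (does (startsAt? v c)))
    indicator-linExt c = split (isLinearExtension? (suc n) A (lookup c))
      where
      split : (d : Dec (IsLinearExtension (suc n) A (lookup c))) →
              indicator (does d) ≡ sum (λ v → indicator (does (d ×-dec (lookup c v FP.≟ zero))))
      split (no _) = sym (Σℕ.sum-replicate-zero (suc n))
      split (yes (inj , surj , _)) =
        sym (trans (sum-delta first w others) (cong indicator (dec-true (lookup c w FP.≟ zero) (proj₂ (surj zero)))))
        where
        first : Fin (suc n) → ℕ
        first v = indicator (does (lookup c v FP.≟ zero))
        w : Fin (suc n)
        w = proj₁ (surj zero)
        others : ∀ v → v ≢ w → first v ≡ 0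
        others v v≢w = cong indicator (dec-false (lookup c v FP.≟ zero)
                         (λ e → v≢w (inj v w (trans e (sym (proj₂ (surj zero)))))))

    #linExt≡sum-#startsAt : #linExt (suc n) A ≡ sum #startsAt
    #linExt≡sum-#startsAt = begin
      #linExt (suc n) A
        ≡⟨ count≡sum-indicator _ (allMaps (suc n)) ⟩
      listSum (map (λ c → indicator (does (isLinearExtension? (suc n) A (lookup c)))) (allMaps (suc n)))
        ≡⟨ cong listSum (LP.map-cong indicator-linExt (allMaps (suc n))) ⟩
      listSum (map (λ c → sum (λ v → indicator (does (startsAt? v c)))) (allMaps (suc n)))
        ≡⟨ listSum-sum-comm (λ c v → indicator (does (startsAt? v c))) (allMaps (suc n)) ⟩
      sum (λ v → listSum (map (λ c → indicator (does (startsAt? v c))) (allMaps (suc n))))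
        ≡⟨ Σℕ.sum-cong-≗ (λ v → sym (count≡sum-indicator (startsAt? v) (allMaps (suc n)))) ⟩
      sum #startsAt ∎
      where open ≡-Reasoning

    linExt? : ∀ {m} (A′ : BoolRel m) → Decidable (λ (c : Vec (Fin m) m) → IsLinearExtension m A′ (lookup c))
    linExt? {m} A′ c = isLinearExtension? m A′ (lookup c)

    #startsAt-nonsource : ∀ v → isSource A v ≡ false → #startsAt v ≡ 0
    #startsAt-nonsource v nonsource = count-none (startsAt? v) (allMaps (suc n)) λ c (linExt , cv≡0) →
      let (u , a) = isSource-false A v nonsource in
      ℕP.n≮0 (subst (λ z → Fin.toℕ (lookup c u) < Fin.toℕ z) cv≡0 (proj₂ (proj₂ linExt) u v a))

    #startsAt≤ : ∀ v → #startsAt v ≤ #linExt n (removeVertex v A)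
    #startsAt≤ v = count-≤-injection (startsAt? v) (linExt? (removeVertex v A)) (allMaps-unique _) (allMaps-complete _)
                     restrict restrict-ok restrict-inj
      where
      restrict : Vec (Fin (suc n)) (suc n) → Vec (Fin n) n
      restrict c = tabulate (restrictAfter v (lookup c))
      restrict-ok : ∀ c → StartsAt v c → IsLinearExtension n (removeVertex v A) (lookup (restrict c))
      restrict-ok c (linExt , cv≡0) =
        IsLinearExtension-cong (λ x → sym (VP.lookup∘tabulate _ x)) (restrictAfter-linExt A v (lookup c) linExt cv≡0)
      restrict-inj : ∀ c₁ c₂ → StartsAt v c₁ → StartsAt v c₂ → restrict c₁ ≡ restrict c₂ → c₁ ≡ c₂
      restrict-inj c₁ c₂ (linExt₁ , c₁v≡0) (linExt₂ , c₂v≡0) e = lookup-extensionality c₁ c₂ agree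
        where
        agree : ∀ y → lookup c₁ y ≡ lookup c₂ y
        agree y with punchIn-view v y
        ... | inj₁ refl = trans c₁v≡0 (sym c₂v≡0)
        ... | inj₂ (x , refl) =
          trans (sym (suc-restrictAfter A v _ (proj₁ linExt₁) c₁v≡0 x))
            (trans (cong suc (trans (sym (VP.lookup∘tabulate _ x))
                               (trans (cong (λ w → lookup w x) e) (VP.lookup∘tabulate _ x))))
                   (suc-restrictAfter A v _ (proj₁ linExt₂) c₂v≡0 x))

    ≤#startsAt : ∀ v → isSource A v ≡ true → #linExt n (removeVertex v A) ≤ #startsAt v
    ≤#startsAt v source = count-≤-injection (linExt? (removeVertex v A)) (startsAt? v) (allMaps-unique _) (allMaps-complete _)
                            prepend prepend-ok prepend-inj
      where
      prepend : Vec (Fin n) n → Vec (Fin (suc n)) (suc n)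
      prepend c = tabulate (prependAt v (lookup c))
      lookup-prepend : ∀ c y → lookup (prepend c) y ≡ prependAt v (lookup c) y
      lookup-prepend c = VP.lookup∘tabulate (prependAt v (lookup c))
      prepend-ok : ∀ c → IsLinearExtension n (removeVertex v A) (lookup c) → StartsAt v (prepend c)
      prepend-ok c linExt =
          IsLinearExtension-cong (sym ∘ lookup-prepend c) (prependAt-linExt A v (lookup c) linExt (isSource-true A v source))
        , trans (lookup-prepend c v) (prependAt-self v (lookup c))
      prepend-inj : ∀ c₁ c₂ → IsLinearExtension n (removeVertex v A) (lookup c₁) →
                    IsLinearExtension n (removeVertex v A) (lookup c₂) → prepend c₁ ≡ prepend c₂ → c₁ ≡ c₂
      prepend-inj c₁ c₂ _ _ e = lookup-extensionality c₁ c₂ λ x → FP.suc-injective (begin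
        suc (lookup c₁ x)                     ≡⟨ sym (prependAt-punchIn v (lookup c₁) x) ⟩
        prependAt v (lookup c₁) (punchIn v x) ≡⟨ sym (lookup-prepend c₁ (punchIn v x)) ⟩
        lookup (prepend c₁) (punchIn v x)     ≡⟨ cong (λ w → lookup w (punchIn v x)) e ⟩
        lookup (prepend c₂) (punchIn v x)     ≡⟨ lookup-prepend c₂ (punchIn v x) ⟩
        prependAt v (lookup c₂) (punchIn v x) ≡⟨ prependAt-punchIn v (lookup c₂) x ⟩
        suc (lookup c₂ x)                     ∎)
        where open ≡-Reasoning

    #startsAt≡ : ∀ v → #startsAt v ≡ (if isSource A v then #linExt n (removeVertex v A) else 0)
    #startsAt≡ v with isSource A v in source?
    ... | false = #startsAt-nonsource v source?
    ... | true  = ℕP.≤-antisym (#startsAt≤ v) (≤#startsAt v source?)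

    #linExt-suc : #linExt (suc n) A ≡ sum λ v → if isSource A v then #linExt n (removeVertex v A) else 0
    #linExt-suc = trans #linExt≡sum-#startsAt (Σℕ.sum-cong-≗ #startsAt≡)

  #linExt≡orderings : ∀ n A → #linExt n A ≡ orderings n A
  #linExt≡orderings zero    A = refl
  #linExt≡orderings (suc n) A = trans (SourceRecursion.#linExt-suc A) (Σℕ.sum-cong-≗ same)
    where
    same : ∀ v → (if isSource A v then #linExt n (removeVertex v A) else 0)
               ≡ (if isSource A v then orderings n (removeVertex v A) else 0)
    same v = cong (if isSource A v then_else 0) (#linExt≡orderings n (removeVertex v A))

  ℓG≡orderings : ∀ G → ℓG G ≡ orderings (n G) (A G)
  ℓG≡orderings G = #linExt≡orderings (n G) (A G)

  -- Relabelling

  pullback : ∀ {a} {X : Set a} {k} → (X → X → Bool) → (Fin k → X) → BoolRel k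
  pullback R σ x y = R (σ x) (σ y)

  isSource-relabel : ∀ {n m} {A : BoolRel n} {B : BoolRel m} (π : Permutation n m) →
                     (∀ x y → A x y ≡ B (π ⟨$⟩ʳ x) (π ⟨$⟩ʳ y)) → ∀ v → isSource A v ≡ isSource B (π ⟨$⟩ʳ v)
  isSource-relabel {A = A} {B} π h v =
    does-cong (FP.all? λ x → A x v BP.≟ false) (FP.all? λ y → B y (π ⟨$⟩ʳ v) BP.≟ false)
      (λ f y → trans (cong (λ z → B z (π ⟨$⟩ʳ v)) (sym (Perm.inverseʳ π))) (trans (sym (h _ v)) (f _)))
      (λ g x → trans (h x v) (g _))

  sourceTerm-relabel : ∀ {n m} {A : BoolRel (suc n)} {B : BoolRel (suc m)} (π : Permutation (suc n) (suc m)) →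
                       (∀ x y → A x y ≡ B (π ⟨$⟩ʳ x) (π ⟨$⟩ʳ y)) →
                       ∀ v → sourceTerm A v ≡ sourceTerm B (π ⟨$⟩ʳ v)

  orderings-relabel : ∀ {n m} {A : BoolRel n} {B : BoolRel m} (π : Permutation n m) →
                      (∀ x y → A x y ≡ B (π ⟨$⟩ʳ x) (π ⟨$⟩ʳ y)) → orderings n A ≡ orderings m B
  orderings-relabel {zero}  {zero}  π h = refl
  orderings-relabel {zero}  {suc m} π h with π ⟨$⟩ˡ zero
  ... | ()
  orderings-relabel {suc n} {zero}  π h with π ⟨$⟩ʳ zero
  ... | ()
  orderings-relabel {suc n} {suc m} {A} {B} π h =
    trans (Σℕ.sum-cong-≗ (sourceTerm-relabel {A = A} {B} π h)) (sym (Σℕ.sum-permute (sourceTerm B) π))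

  sourceTerm-relabel {A = A} {B} π h v =
    cong₂ (if_then_else 0) (isSource-relabel {A = A} {B} π h v)
      (orderings-relabel {A = removeVertex v A} {removeVertex (π ⟨$⟩ʳ v) B} (Perm.remove v π)
        (λ x y → trans (h _ _) (cong₂ B (Perm.punchIn-permute π v x) (Perm.punchIn-permute π v y))))

  orderings-cong : ∀ {n} {A B : BoolRel n} → (∀ x y → A x y ≡ B x y) → orderings n A ≡ orderings n B
  orderings-cong = orderings-relabel Perm.id

  Enumerates : ∀ {a p} {X : Set a} {k} → Pred X p → (Fin k → X) → Set (a ⊔ p)
  Enumerates P σ = Injective _≡_ _≡_ σ × (∀ z → P (σ z)) × (∀ w → P w → ∃ λ z → σ z ≡ w)

  module _ {a p} {X : Set a} {P : Pred X p} where

    enumerations-permutation : ∀ {k k′} {σ : Fin k → X} {σ′ : Fin k′ → X} → Enumerates P σ → Enumerates P σ′ →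
                               Σ (Permutation k k′) λ π → ∀ x → σ′ (π ⟨$⟩ʳ x) ≡ σ x
    enumerations-permutation {k} {k′} {σ} {σ′} (inj , mem , onto) (inj′ , mem′ , onto′) =
        Perm.permutation to from (λ x′ → inj′ (trans (proj₂ (onto′ _ _)) (proj₂ (onto _ _))))
                                 (λ x → inj (trans (proj₂ (onto _ _)) (proj₂ (onto′ _ _))))
      , (λ x → proj₂ (onto′ (σ x) (mem x)))
      where
      to : Fin k → Fin k′
      to x = proj₁ (onto′ (σ x) (mem x))
      from : Fin k′ → Fin k
      from x′ = proj₁ (onto (σ′ x′) (mem′ x′))

    orderings-reenumerate : ∀ {k k′} (R : X → X → Bool) {σ : Fin k → X} {σ′ : Fin k′ → X} →
                            Enumerates P σ → Enumerates P σ′ →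
                            orderings k (pullback R σ) ≡ orderings k′ (pullback R σ′)
    orderings-reenumerate R e e′ with enumerations-permutation e e′
    ... | π , σ′∘π≡σ = orderings-relabel π (λ x y → sym (cong₂ R (σ′∘π≡σ x) (σ′∘π≡σ y)))

  -- Disjoint unions

  -- A (G ⊔G H) unfolds to A G ⊕ A H.
  _⊕_ : ∀ {n m} → BoolRel n → BoolRel m → BoolRel (n + m)
  _⊕_ {n} A B x y = comb A B (splitAt n x) (splitAt n y)

  ⊕-swap : ∀ {n m} → Permutation (n + m) (m + n)
  ⊕-swap {n} {m} = (↔-sym (FP.+↔⊎ {m} {n}) ↔-∘ SumP.swap-↔) ↔-∘ FP.+↔⊎ {n} {m}

  ⊕-swap-relabels : ∀ {n m} (A : BoolRel n) (B : BoolRel m) x y →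
                    (A ⊕ B) x y ≡ (B ⊕ A) (⊕-swap {n} {m} ⟨$⟩ʳ x) (⊕-swap {n} {m} ⟨$⟩ʳ y)
  ⊕-swap-relabels {n} {m} A B x y =
    trans (comb-swap (splitAt n x) (splitAt n y))
          (sym (cong₂ (comb B A) (FP.splitAt-join m n (Sum.swap (splitAt n x)))
                                 (FP.splitAt-join m n (Sum.swap (splitAt n y)))))
    where
    comb-swap : ∀ u u′ → comb A B u u′ ≡ comb B A (Sum.swap u) (Sum.swap u′)
    comb-swap (inj₁ _) (inj₁ _) = refl
    comb-swap (inj₁ _) (inj₂ _) = refl
    comb-swap (inj₂ _) (inj₁ _) = refl
    comb-swap (inj₂ _) (inj₂ _) = refl

  ⊕-comm : ∀ {n m} (A : BoolRel n) (B : BoolRel m) → orderings (n + m) (A ⊕ B) ≡ orderings (m + n) (B ⊕ A)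
  ⊕-comm {n} {m} A B = orderings-relabel {A = A ⊕ B} {B ⊕ A} (⊕-swap {n} {m}) (⊕-swap-relabels A B)

  splitAt-punchIn-↑ˡ : ∀ n {m} (x : Fin (suc n)) (z : Fin (n + m)) →
                       splitAt (suc n) (punchIn (x ↑ˡ m) z) ≡ Sum.map₁ (punchIn x) (splitAt n z)
  splitAt-punchIn-↑ˡ n       zero    z       = refl
  splitAt-punchIn-↑ˡ (suc n) (suc x) zero    = refl
  splitAt-punchIn-↑ˡ (suc n) (suc x) (suc z) with splitAt n z | splitAt-punchIn-↑ˡ n x z
  ... | inj₁ _ | e = cong (Sum.map₁ suc) e
  ... | inj₂ _ | e = cong (Sum.map₁ suc) e

  module _ {n m : ℕ} (A : BoolRel (suc n)) (B : BoolRel m) (x : Fin (suc n)) where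

    isSource-⊕ˡ : isSource (A ⊕ B) (x ↑ˡ m) ≡ isSource A x
    isSource-⊕ˡ = does-cong (FP.all? λ w → (A ⊕ B) w (x ↑ˡ m) BP.≟ false) (FP.all? λ a → A a x BP.≟ false)
      (λ h a → trans (sym (cong₂ (comb A B) (FP.splitAt-join (suc n) m (inj₁ a)) (FP.splitAt-join (suc n) m (inj₁ x))))
                     (h (a ↑ˡ m)))
      (λ h w → trans (cong (comb A B (splitAt (suc n) w)) (FP.splitAt-↑ˡ (suc n) x m)) (into-x (splitAt (suc n) w) h))
      where
      into-x : ∀ u → (∀ a → A a x ≡ false) → comb A B u (inj₁ x) ≡ false
      into-x (inj₁ a) h = h a
      into-x (inj₂ b) h = refl

    removeVertex-⊕ˡ : ∀ z z′ → removeVertex (x ↑ˡ m) (A ⊕ B) z z′ ≡ (removeVertex x A ⊕ B) z z′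
    removeVertex-⊕ˡ z z′ =
      trans (cong₂ (comb A B) (splitAt-punchIn-↑ˡ n x z) (splitAt-punchIn-↑ˡ n x z′))
            (comb-map₁ (splitAt n z) (splitAt n z′))
      where
      comb-map₁ : ∀ u u′ → comb A B (Sum.map₁ (punchIn x) u) (Sum.map₁ (punchIn x) u′) ≡ comb (removeVertex x A) B u u′
      comb-map₁ (inj₁ _) (inj₁ _) = refl
      comb-map₁ (inj₁ _) (inj₂ _) = refl
      comb-map₁ (inj₂ _) (inj₁ _) = refl
      comb-map₁ (inj₂ _) (inj₂ _) = refl

    sourceTerm-⊕ˡ : sourceTerm (A ⊕ B) (x ↑ˡ m) ≡ (if isSource A x then orderings (n + m) (removeVertex x A ⊕ B) else 0)
    sourceTerm-⊕ˡ = cong₂ (if_then_else 0) isSource-⊕ˡ (orderings-cong {A = removeVertex (x ↑ˡ m) (A ⊕ B)} removeVertex-⊕ˡ)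

  if-*ʳ : ∀ (s : Bool) a c → (if s then a else 0) * c ≡ (if s then a * c else 0)
  if-*ʳ true  a c = refl
  if-*ʳ false a c = refl

  if-*ˡ : ∀ (s : Bool) a c → c * (if s then a else 0) ≡ (if s then c * a else 0)
  if-*ˡ true  a c = refl
  if-*ˡ false a c = ℕP.*-zeroʳ c

  orderings-⊕ : ∀ n m (A : BoolRel n) (B : BoolRel m) →
                orderings (n + m) (A ⊕ B) ≡ ((n + m) C n) * (orderings n A * orderings m B)
  orderings-⊕ zero    m       A B = sym (begin
    (m C 0) * (1 * orderings m B) ≡⟨ cong (λ k → k * (1 * orderings m B)) (trans (nCk≡nC[n∸k] {0} {m} z≤n) (nCn≡1 m)) ⟩
    1 * (1 * orderings m B)     ≡⟨ trans (ℕP.*-identityˡ _) (ℕP.*-identityˡ _) ⟩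
    orderings m B               ∎)
    where open ≡-Reasoning
  orderings-⊕ (suc n) zero    A B = trans (⊕-comm A B) (sym (collapse (orderings (suc n) A) K≡1))
    where
    K≡1 : (suc n + 0) C suc n ≡ 1
    K≡1 = trans (cong (_C suc n) (ℕP.+-identityʳ (suc n))) (nCn≡1 (suc n))
    collapse : ∀ {K} L → K ≡ 1 → K * (L * 1) ≡ L
    collapse L refl = trans (ℕP.*-identityˡ (L * 1)) (ℕP.*-identityʳ L)
  orderings-⊕ (suc n) (suc m) A B = begin
    orderings (suc n + suc m) (A ⊕ B)
      ≡⟨ sum-split (suc n) {suc m} (sourceTerm (A ⊕ B)) ⟩
    sum {suc n} (λ x → sourceTerm (A ⊕ B) (x ↑ˡ suc m)) + sum {suc m} (λ y → sourceTerm (A ⊕ B) (suc n ↑ʳ y))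
      ≡⟨ cong₂ _+_ (Σℕ.sum-cong-≗ left) (Σℕ.sum-cong-≗ right) ⟩
    sum {suc n} (λ x → Kˡ * (sourceTerm A x * LB)) + sum {suc m} (λ y → Kʳ * (LA * sourceTerm B y))
      ≡⟨ cong₂ _+_ (sym (trans (cong (Kˡ *_) (Σℕ.*-distribʳ-sum LB (sourceTerm A)))
                               (Σℕ.*-distribˡ-sum Kˡ (λ x → sourceTerm A x * LB))))
                   (sym (trans (cong (Kʳ *_) (Σℕ.*-distribˡ-sum LA (sourceTerm B)))
                               (Σℕ.*-distribˡ-sum Kʳ (λ y → LA * sourceTerm B y)))) ⟩
    Kˡ * (LA * LB) + Kʳ * (LA * LB)
      ≡⟨ sym (ℕP.*-distribʳ-+ (LA * LB) Kˡ Kʳ) ⟩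
    (Kˡ + Kʳ) * (LA * LB)
      ≡⟨ cong (_* (LA * LB)) pascal ⟩
    ((suc n + suc m) C suc n) * (LA * LB) ∎
    where
    open ≡-Reasoning
    LA LB Kˡ Kʳ : ℕ
    LA = orderings (suc n) A
    LB = orderings (suc m) B
    Kˡ = (n + suc m) C n
    Kʳ = (suc n + m) C suc n
    left : ∀ x → sourceTerm (A ⊕ B) (x ↑ˡ suc m) ≡ Kˡ * (sourceTerm A x * LB)
    left x = begin
      sourceTerm (A ⊕ B) (x ↑ˡ suc m)
        ≡⟨ sourceTerm-⊕ˡ A B x ⟩
      (if isSource A x then orderings (n + suc m) (removeVertex x A ⊕ B) else 0)
        ≡⟨ cong (if isSource A x then_else 0) (orderings-⊕ n (suc m) (removeVertex x A) B) ⟩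
      (if isSource A x then Kˡ * (orderings n (removeVertex x A) * LB) else 0)
        ≡⟨ sym (if-*ˡ (isSource A x) _ Kˡ) ⟩
      Kˡ * (if isSource A x then orderings n (removeVertex x A) * LB else 0)
        ≡⟨ cong (Kˡ *_) (sym (if-*ʳ (isSource A x) _ LB)) ⟩
      Kˡ * (sourceTerm A x * LB) ∎
    swap-↑ʳ : ∀ y → ⊕-swap {suc n} {suc m} ⟨$⟩ʳ (suc n ↑ʳ y) ≡ y ↑ˡ suc n
    swap-↑ʳ y = cong (λ u → join (suc m) (suc n) (Sum.swap u)) (FP.splitAt-↑ʳ (suc n) (suc m) y)
    right : ∀ y → sourceTerm (A ⊕ B) (suc n ↑ʳ y) ≡ Kʳ * (LA * sourceTerm B y)
    right y = begin
      sourceTerm (A ⊕ B) (suc n ↑ʳ y)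
        ≡⟨ sourceTerm-relabel {A = A ⊕ B} {B ⊕ A} (⊕-swap {suc n} {suc m}) (⊕-swap-relabels A B) (suc n ↑ʳ y) ⟩
      sourceTerm (B ⊕ A) (⊕-swap {suc n} {suc m} ⟨$⟩ʳ (suc n ↑ʳ y))
        ≡⟨ cong (sourceTerm (B ⊕ A)) (swap-↑ʳ y) ⟩
      sourceTerm (B ⊕ A) (y ↑ˡ suc n)
        ≡⟨ sourceTerm-⊕ˡ B A y ⟩
      (if isSource B y then orderings (m + suc n) (removeVertex y B ⊕ A) else 0)
        ≡⟨ cong (if isSource B y then_else 0) (trans (⊕-comm (removeVertex y B) A) (orderings-⊕ (suc n) m A (removeVertex y B))) ⟩
      (if isSource B y then Kʳ * (LA * orderings m (removeVertex y B)) else 0)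
        ≡⟨ sym (if-*ˡ (isSource B y) _ Kʳ) ⟩
      Kʳ * (if isSource B y then LA * orderings m (removeVertex y B) else 0)
        ≡⟨ cong (Kʳ *_) (sym (if-*ˡ (isSource B y) _ LA)) ⟩
      Kʳ * (LA * sourceTerm B y) ∎
    pascal : Kˡ + Kʳ ≡ (suc n + suc m) C suc n
    pascal = trans (cong (Kˡ +_) (cong (_C suc n) (sym (ℕP.+-suc n m))))
                   (nCk+nC[k+1]≡[n+1]C[k+1] (n + suc m) n)

  -- Sums over subsets

  sumSubsets : ∀ N → (Vec Bool N → ℕ) → ℕ
  sumSubsets zero    g = g []
  sumSubsets (suc N) g = sumSubsets N (g ∘ (true ∷_)) + sumSubsets N (g ∘ (false ∷_))

  listSum-map-++ : ∀ {a} {X : Set a} (g : X → ℕ) xs ys →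
                   listSum (map g (xs List.++ ys)) ≡ listSum (map g xs) + listSum (map g ys)
  listSum-map-++ g xs ys = trans (cong listSum (LP.map-++ g xs ys)) (listSum-++ (map g xs) (map g ys))

  listSum-allVecs : ∀ N g → listSum (map g (allVecs (true ∷ false ∷ []) N)) ≡ sumSubsets N g
  listSum-allVecs zero    g = ℕP.+-identityʳ (g [])
  listSum-allVecs (suc N) g = begin
    listSum (map g (map (true ∷_) W List.++ (map (false ∷_) W List.++ [])))
      ≡⟨ listSum-map-++ g (map (true ∷_) W) _ ⟩
    listSum (map g (map (true ∷_) W)) + listSum (map g (map (false ∷_) W List.++ []))
      ≡⟨ cong (λ xs → listSum (map g (map (true ∷_) W)) + listSum (map g xs)) (LP.++-identityʳ (map (false ∷_) W)) ⟩
    listSum (map g (map (true ∷_) W)) + listSum (map g (map (false ∷_) W))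
      ≡⟨ cong₂ _+_ (cong listSum (sym (LP.map-∘ W))) (cong listSum (sym (LP.map-∘ W))) ⟩
    listSum (map (g ∘ (true ∷_)) W) + listSum (map (g ∘ (false ∷_)) W)
      ≡⟨ cong₂ _+_ (listSum-allVecs N (g ∘ (true ∷_))) (listSum-allVecs N (g ∘ (false ∷_))) ⟩
    sumSubsets (suc N) g ∎
    where
    open ≡-Reasoning
    W : List (Vec Bool N)
    W = allVecs (true ∷ false ∷ []) N

  sumSubsets-cong : ∀ N {g g′ : Vec Bool N → ℕ} → (∀ I → g I ≡ g′ I) → sumSubsets N g ≡ sumSubsets N g′
  sumSubsets-cong zero    h = h []
  sumSubsets-cong (suc N) h = cong₂ _+_ (sumSubsets-cong N (h ∘ (true ∷_))) (sumSubsets-cong N (h ∘ (false ∷_)))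

  sumSubsets-zero : ∀ N {g : Vec Bool N → ℕ} → (∀ I → g I ≡ 0) → sumSubsets N g ≡ 0
  sumSubsets-zero zero    h = h []
  sumSubsets-zero (suc N) h = cong₂ _+_ (sumSubsets-zero N (h ∘ (true ∷_))) (sumSubsets-zero N (h ∘ (false ∷_)))

  sumSubsets-sum-comm : ∀ N {k} (g : Vec Bool N → Fin k → ℕ) →
                        sumSubsets N (sum ∘ g) ≡ sum (λ v → sumSubsets N (λ I → g I v))
  sumSubsets-sum-comm zero    g = refl
  sumSubsets-sum-comm (suc N) g =
    trans (cong₂ _+_ (sumSubsets-sum-comm N (g ∘ (true ∷_))) (sumSubsets-sum-comm N (g ∘ (false ∷_))))
          (sym (Σℕ.∑-distrib-+ (λ v → sumSubsets N (λ I → g (true ∷ I) v)) (λ v → sumSubsets N (λ I → g (false ∷ I) v))))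

  +-interchange : ∀ a b c d → (a + b) + (c + d) ≡ (a + c) + (b + d)
  +-interchange = CommSemigroupProps.interchange ℕP.+-commutativeSemigroup

  sumSubsets-insertAt : ∀ N (v : Fin (suc N)) g →
    sumSubsets (suc N) g ≡ sumSubsets N (λ I → g (insertAt I v false)) + sumSubsets N (λ I → g (insertAt I v true))
  sumSubsets-insertAt N       zero    g = ℕP.+-comm (sumSubsets N (g ∘ (true ∷_))) (sumSubsets N (g ∘ (false ∷_)))
  sumSubsets-insertAt (suc N) (suc v) g =
    trans (cong₂ _+_ (sumSubsets-insertAt N v (g ∘ (true ∷_))) (sumSubsets-insertAt N v (g ∘ (false ∷_))))
          (+-interchange (part true false) (part true true) (part false false) (part false true))
    where
    part : Bool → Bool → ℕ
    part b b′ = sumSubsets N (λ I → g (b ∷ insertAt I v b′))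

  size≤length : ∀ {N} (I : Vec Bool N) → size I ≤ N
  size≤length []          = z≤n
  size≤length (true ∷ I)  = s≤s (size≤length I)
  size≤length (false ∷ I) = ℕP.m≤n⇒m≤1+n (size≤length I)

  ≡ᵇ-sound : ∀ a b → (a ≡ᵇ b) ≡ true → a ≡ b
  ≡ᵇ-sound a b = from-does-true (a ℕP.≟ b)

  ≡ᵇ-false : ∀ a b → a ≢ b → (a ≡ᵇ b) ≡ false
  ≡ᵇ-false a b = dec-false (a ℕP.≟ b)

  ≡ᵇ-true : ∀ a b → a ≡ b → (a ≡ᵇ b) ≡ true
  ≡ᵇ-true a b = dec-true (a ℕP.≟ b)

  sumSubsets-full : ∀ N (g : Vec Bool N → ℕ) →
                    sumSubsets N (λ I → if size I ≡ᵇ N then g I else 0) ≡ g (V.replicate N true)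
  sumSubsets-full zero    g = refl
  sumSubsets-full (suc N) g =
    trans (cong₂ _+_ (sumSubsets-full N (g ∘ (true ∷_)))
                     (sumSubsets-zero N {λ I → if size I ≡ᵇ suc N then g (false ∷ I) else 0}
                                      λ I → cong (if_then g (false ∷ I) else 0)
                                                (≡ᵇ-false (size I) (suc N) (ℕP.<⇒≢ (s≤s (size≤length I))))))
          (ℕP.+-identityʳ (g (V.replicate (suc N) true)))

  Member : ∀ {N} → Vec Bool N → Pred (Fin N) _
  Member p w = lookup p w ≡ true

  orderingsOn : ∀ {N} → BoolRel N → Vec Bool N → ℕ
  orderingsOn A p = orderings (size p) (pullback A (select p))

  select-injective : ∀ {N} (p : Vec Bool N) → Injective _≡_ _≡_ (select p)
  select-injective (true ∷ p)  {zero}  {zero}  e = refl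
  select-injective (true ∷ p)  {suc x} {suc y} e = cong suc (select-injective p (FP.suc-injective e))
  select-injective (false ∷ p)                 e = select-injective p (FP.suc-injective e)

  select-member : ∀ {N} (p : Vec Bool N) z → Member p (select p z)
  select-member (true ∷ p)  zero    = refl
  select-member (true ∷ p)  (suc z) = select-member p z
  select-member (false ∷ p) z       = select-member p z

  select-onto : ∀ {N} (p : Vec Bool N) w → Member p w → ∃ λ z → select p z ≡ w
  select-onto (true ∷ p)  zero    _ = zero , refl
  select-onto (true ∷ p)  (suc w) h with select-onto p w h
  ... | z , e = suc z , cong suc e
  select-onto (false ∷ p) (suc w) h with select-onto p w h
  ... | z , e = z , cong suc e

  select-enumerates : ∀ {N} (p : Vec Bool N) → Enumerates (Member p) (select p)
  select-enumerates p = select-injective p , select-member p , select-onto p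

  orderingsOn-enumeration : ∀ {N k} (A : BoolRel N) (p : Vec Bool N) {σ : Fin k → Fin N} →
                            Enumerates (Member p) σ → orderingsOn A p ≡ orderings k (pullback A σ)
  orderingsOn-enumeration A p = orderings-reenumerate A (select-enumerates p)

  sum-select : ∀ {N} (p : Vec Bool N) (g : Fin N → ℕ) → sum (g ∘ select p) ≡ sum (λ v → if lookup p v then g v else 0)
  sum-select []          g = refl
  sum-select (true ∷ p)  g = cong (g zero +_) (sum-select p (g ∘ suc))
  sum-select (false ∷ p) g = sum-select p (g ∘ suc)

  sum-enumeration : ∀ {N k} (p : Vec Bool N) {σ : Fin k → Fin N} → Enumerates (Member p) σ → (g : Fin N → ℕ) →
                    sum (g ∘ σ) ≡ sum (λ v → if lookup p v then g v else 0)
  sum-enumeration p e g with enumerations-permutation e (select-enumerates p)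
  ... | π , select∘π≡σ = trans (Σℕ.sum-cong-≗ (cong g ∘ sym ∘ select∘π≡σ))
                               (trans (sym (Σℕ.sum-permute (g ∘ select p) π)) (sum-select p g))

  enumerates-remove : ∀ {N k} (p : Vec Bool N) {σ : Fin (suc k) → Fin N} → Enumerates (Member p) σ → ∀ u →
                      Enumerates (Member (p [ σ u ]≔ false)) (σ ∘ punchIn u)
  enumerates-remove {N} p {σ} (inj , mem , onto) u = inj′ , mem′ , onto′
    where
    p′ : Vec Bool N
    p′ = p [ σ u ]≔ false
    p′-σu : lookup p′ (σ u) ≡ false
    p′-σu = VP.lookup∘updateAt (σ u) p
    p′-other : ∀ w → w ≢ σ u → lookup p′ w ≡ lookup p w
    p′-other w w≢σu = VP.lookup∘updateAt′ w (σ u) w≢σu p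
    inj′ : Injective _≡_ _≡_ (σ ∘ punchIn u)
    inj′ e = FP.punchIn-injective u _ _ (inj e)
    mem′ : ∀ z → Member p′ (σ (punchIn u z))
    mem′ z = trans (p′-other _ (FP.punchInᵢ≢i u z ∘ inj)) (mem _)
    onto′ : ∀ w → Member p′ w → ∃ λ z → σ (punchIn u z) ≡ w
    onto′ w h with onto w (trans (sym (p′-other w w≢σu)) h)
      where
      w≢σu : w ≢ σ u
      w≢σu refl = false≢true (trans (sym p′-σu) h)
    ... | x , σx≡w = punchOut u≢x , trans (cong σ (FP.punchIn-punchOut u≢x)) σx≡w
      where
      u≢x : u ≢ x
      u≢x refl = false≢true (trans (sym p′-σu) (trans (cong (lookup p′) σx≡w) h))

  isSourceIn : ∀ {N} → BoolRel N → Vec Bool N → Fin N → Bool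
  isSourceIn A p v = does (FP.all? λ w → (lookup p w BP.≟ true) →-dec (A w v BP.≟ false))

  isSource-enumeration : ∀ {N k} (A : BoolRel N) (p : Vec Bool N) {σ : Fin k → Fin N} → Enumerates (Member p) σ →
                         ∀ u → isSource (pullback A σ) u ≡ isSourceIn A p (σ u)
  isSource-enumeration A p {σ} (_ , mem , onto) u =
    does-cong (FP.all? λ x → A (σ x) (σ u) BP.≟ false) (FP.all? λ w → (lookup p w BP.≟ true) →-dec (A w (σ u) BP.≟ false))
      (λ h w pw → let (x , σx≡w) = onto w pw in subst (λ t → A t (σ u) ≡ false) σx≡w (h x))
      (λ h x → h (σ x) (mem x))

  orderings-enumeration-expand : ∀ {N k} (A : BoolRel N) (p : Vec Bool N) {σ : Fin (suc k) → Fin N} →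
    Enumerates (Member p) σ →
    orderings (suc k) (pullback A σ)
      ≡ sum (λ v → if lookup p v then (if isSourceIn A p v then orderingsOn A (p [ v ]≔ false) else 0) else 0)
  orderings-enumeration-expand A p {σ} e =
    trans (Σℕ.sum-cong-≗ λ u → cong₂ (if_then_else 0) (isSource-enumeration A p e u)
                                     (sym (orderingsOn-enumeration A (p [ σ u ]≔ false) (enumerates-remove p e u))))
          (sum-enumeration p e (λ v → if isSourceIn A p v then orderingsOn A (p [ v ]≔ false) else 0))

  orderingsOn-expand : ∀ {N} (A : BoolRel N) (p : Vec Bool N) → size p ≢ 0 →
    orderingsOn A p ≡ sum (λ v → if lookup p v then (if isSourceIn A p v then orderingsOn A (p [ v ]≔ false) else 0) else 0)
  orderingsOn-expand A p nonempty with size p | select p | select-enumerates p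
  ... | zero  | _ | _ = ⊥-elim (nonempty refl)
  ... | suc k | σ | e = orderings-enumeration-expand A p e

  -- Ideals

  -- IsIdeal G I and isIdeal? G I unfold to IsIdealOf (A G) I and isIdealOf? (A G) I.
  IsIdealOf : ∀ {N} → BoolRel N → Vec Bool N → Set
  IsIdealOf A I = ∀ x y → lookup I x ≡ true → A x y ≡ true → lookup I y ≡ true

  isIdealOf? : ∀ {N} (A : BoolRel N) (I : Vec Bool N) → Dec (IsIdealOf A I)
  isIdealOf? A I = FP.all? λ x → FP.all? λ y →
    (lookup I x BP.≟ true) →-dec (A x y BP.≟ true) →-dec (lookup I y BP.≟ true)

  complement : ∀ {N} → Vec Bool N → Vec Bool N
  complement = V.map not

  size-complement : ∀ {N} (I : Vec Bool N) → size (complement I) + size I ≡ N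
  size-complement []          = refl
  size-complement (true ∷ I)  = trans (ℕP.+-suc _ _) (cong suc (size-complement I))
  size-complement (false ∷ I) = cong suc (size-complement I)

  size-insertAt-false : ∀ {N} (I : Vec Bool N) v → size (insertAt I v false) ≡ size I
  size-insertAt-false I           zero    = refl
  size-insertAt-false (true ∷ I)  (suc v) = cong suc (size-insertAt-false I v)
  size-insertAt-false (false ∷ I) (suc v) = size-insertAt-false I v

  complement-insertAt : ∀ {N} (I : Vec Bool N) v →
                        complement (insertAt I v false) [ v ]≔ false ≡ insertAt (complement I) v false
  complement-insertAt I       zero    = refl
  complement-insertAt (x ∷ I) (suc v) = cong (not x ∷_) (complement-insertAt I v)

  lookup-complement-insertAt : ∀ {N} (I : Vec Bool N) v b → lookup (complement (insertAt I v b)) v ≡ not b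
  lookup-complement-insertAt I v b = trans (VP.lookup-map v not (insertAt I v b)) (cong not (VP.insertAt-lookup I v b))

  -- no arc enters the complement of an ideal from the ideal
  isSourceIn-complement : ∀ {N} (A : BoolRel N) (I : Vec Bool N) v → IsIdealOf A I →
                          lookup (complement I) v ≡ true → isSourceIn A (complement I) v ≡ isSource A v
  isSourceIn-complement A I v ideal v∉I =
    does-cong (FP.all? λ w → (lookup (complement I) w BP.≟ true) →-dec (A w v BP.≟ false))
              (FP.all? λ w → A w v BP.≟ false) sourceIn⇒source (λ h w _ → h w)
    where
    lookup-complement : ∀ w → lookup (complement I) w ≡ not (lookup I w)
    lookup-complement w = VP.lookup-map w not I
    Iv≡false : lookup I v ≡ false
    Iv≡false = BP.not-injective (trans (sym (lookup-complement v)) v∉I)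
    sourceIn⇒source : (∀ w → lookup (complement I) w ≡ true → A w v ≡ false) → ∀ w → A w v ≡ false
    sourceIn⇒source h w with lookup I w in Iw | A w v in Awv
    ... | false | _     = trans (sym Awv) (h w (trans (lookup-complement w) (cong not Iw)))
    ... | true  | false = refl
    ... | true  | true  = ⊥-elim (false≢true (trans (sym Iv≡false) (ideal w v Iw Awv)))

  insertAt-enumerates : ∀ {N} v (q : Vec Bool N) → Enumerates (Member (insertAt q v false)) (punchIn v ∘ select q)
  insertAt-enumerates v q = inj , mem , onto
    where
    inj : Injective _≡_ _≡_ (punchIn v ∘ select q)
    inj e = select-injective q (FP.punchIn-injective v _ _ e)
    mem : ∀ z → Member (insertAt q v false) (punchIn v (select q z))
    mem z = trans (VP.insertAt-punchIn q v false (select q z)) (select-member q z)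
    onto : ∀ w → Member (insertAt q v false) w → ∃ λ z → punchIn v (select q z) ≡ w
    onto w h with punchIn-view v w
    ... | inj₁ refl = ⊥-elim (false≢true (trans (sym (VP.insertAt-lookup q v false)) h))
    ... | inj₂ (x , refl) with select-onto q x (trans (sym (VP.insertAt-punchIn q v false x)) h)
    ...   | z , e = z , cong (punchIn v) e

  orderingsOn-insertAt : ∀ {N} (A : BoolRel (suc N)) v (q : Vec Bool N) →
                         orderingsOn A (insertAt q v false) ≡ orderingsOn (removeVertex v A) q
  orderingsOn-insertAt A v q = orderingsOn-enumeration A (insertAt q v false) (insertAt-enumerates v q)

  isIdeal-insertAt : ∀ {N} (A : BoolRel (suc N)) v → isSource A v ≡ true → ∀ (I : Vec Bool N) →
                     does (isIdealOf? A (insertAt I v false)) ≡ does (isIdealOf? (removeVertex v A) I)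
  isIdeal-insertAt A v source I = does-cong (isIdealOf? A (insertAt I v false)) (isIdealOf? (removeVertex v A) I) to from
    where
    to : IsIdealOf A (insertAt I v false) → IsIdealOf (removeVertex v A) I
    to ideal x y Ix a = trans (sym (VP.insertAt-punchIn I v false y))
                              (ideal (punchIn v x) (punchIn v y) (trans (VP.insertAt-punchIn I v false x) Ix) a)
    from : IsIdealOf (removeVertex v A) I → IsIdealOf A (insertAt I v false)
    from ideal x y Ix a with punchIn-view v x | punchIn-view v y
    ... | inj₁ refl        | _                = ⊥-elim (false≢true (trans (sym (VP.insertAt-lookup I v false)) Ix))
    ... | inj₂ _           | inj₁ refl        = ⊥-elim (false≢true (trans (sym (isSource-true A v source x)) a))
    ... | inj₂ (x′ , refl) | inj₂ (y′ , refl) =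
      trans (VP.insertAt-punchIn I v false y′) (ideal x′ y′ (trans (sym (VP.insertAt-punchIn I v false x′)) Ix) a)

  if-∧ : ∀ a b (x : ℕ) → (if a then (if b then x else 0) else 0) ≡ (if a ∧ b then x else 0)
  if-∧ true  b x = refl
  if-∧ false b x = refl

  if-∧-swap : ∀ a b (x : ℕ) → (if a ∧ b then x else 0) ≡ (if b then (if a then x else 0) else 0)
  if-∧-swap true  b     x = refl
  if-∧-swap false true  x = refl
  if-∧-swap false false x = refl

  if-zero : ∀ a → (if a then 0 else 0) ≡ 0
  if-zero true  = refl
  if-zero false = refl

  if-congʳ : ∀ a {x y : ℕ} → (a ≡ true → x ≡ y) → (if a then x else 0) ≡ (if a then y else 0)
  if-congʳ true  h = h refl
  if-congʳ false h = refl

  ∧-true : ∀ {a b} → a ∧ b ≡ true → a ≡ true × b ≡ true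
  ∧-true {true} {true} _ = refl , refl

  sumSubsets-if : ∀ N s (g : Vec Bool N → ℕ) → sumSubsets N (λ I → if s then g I else 0) ≡ (if s then sumSubsets N g else 0)
  sumSubsets-if N true  g = refl
  sumSubsets-if N false g = sumSubsets-zero N (λ _ → refl)

  sum-guard : ∀ {k} (g : Bool) (a : Fin k → Bool) X Y (Z : Fin k → ℕ) →
              (g ≡ true → X ≡ sum (λ v → if a v then Z v else 0)) →
              (if g then X * Y else 0) ≡ sum (λ v → if a v then (if g then Z v * Y else 0) else 0)
  sum-guard false a X Y Z _ = sym (sum-zero _ (if-zero ∘ a))
  sum-guard true  a X Y Z h =
    trans (cong (_* Y) (h refl)) (trans (Σℕ.*-distribʳ-sum Y (λ v → if a v then Z v else 0)) (Σℕ.sum-cong-≗ λ v → if-*ʳ (a v) (Z v) Y))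

  orderingsOn-replicate : ∀ {N} (A : BoolRel N) → orderingsOn A (V.replicate N true) ≡ orderings N A
  orderingsOn-replicate {N} A = orderingsOn-enumeration A (V.replicate N true)
    ((λ e → e) , (λ z → VP.lookup-replicate z true) , (λ w _ → w , refl))

  orderingsOn-empty : ∀ {N} (A : BoolRel N) (p : Vec Bool N) → size p ≡ 0 → orderingsOn A p ≡ 1
  orderingsOn-empty A p empty with size p | select p
  ... | zero | _ = refl

  size-complement-replicate : ∀ N → size (complement (V.replicate N true)) ≡ 0
  size-complement-replicate zero    = refl
  size-complement-replicate (suc N) = size-complement-replicate N

  idealGuard : ∀ {N} → BoolRel N → ℕ → Vec Bool N → Bool
  idealGuard A j I = does (isIdealOf? A I) ∧ (size I ≡ᵇ j)

  idealTerm : ∀ {N} → BoolRel N → ℕ → Vec Bool N → ℕ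
  idealTerm A j I = if idealGuard A j I then orderingsOn A (complement I) * orderingsOn A I else 0

  -- idealTerm A j I, split according to the first vertex v of the complement of I
  removalTerm : ∀ {N} → BoolRel N → ℕ → Vec Bool N → Fin N → ℕ
  removalTerm A j I v =
    if lookup (complement I) v ∧ isSource A v
    then (if idealGuard A j I then orderingsOn A (complement I [ v ]≔ false) * orderingsOn A I else 0)
    else 0

  idealTerm≡sum-removalTerm : ∀ {N} (A : BoolRel (suc N)) j → j ≤ N → ∀ I → idealTerm A j I ≡ sum (removalTerm A j I)
  idealTerm≡sum-removalTerm {N} A j j≤N I =
    sum-guard (idealGuard A j I) (λ v → lookup (complement I) v ∧ isSource A v)
              (orderingsOn A (complement I)) (orderingsOn A I) (λ v → orderingsOn A (complement I [ v ]≔ false)) expand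
    where
    expand : idealGuard A j I ≡ true →
             orderingsOn A (complement I)
               ≡ sum (λ v → if lookup (complement I) v ∧ isSource A v then orderingsOn A (complement I [ v ]≔ false) else 0)
    expand guard = trans (orderingsOn-expand A (complement I) nonempty) (Σℕ.sum-cong-≗ λ v →
        trans (if-congʳ (lookup (complement I) v) λ v∉I →
                 cong (if_then orderingsOn A (complement I [ v ]≔ false) else 0) (isSourceIn-complement A I v ideal v∉I))
              (if-∧ (lookup (complement I) v) (isSource A v) _))
      where
      ideal : IsIdealOf A I
      ideal = from-does-true (isIdealOf? A I) (proj₁ (∧-true guard))
      size≡j : size I ≡ j
      size≡j = ≡ᵇ-sound (size I) j (proj₂ (∧-true guard))
      nonempty : size (complement I) ≢ 0
      nonempty empty = ℕP.<-irrefl refl (ℕP.≤-trans (s≤s j≤N)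
        (ℕP.≤-reflexive (trans (sym (size-complement I)) (trans (cong (_+ size I) empty) size≡j))))

  sumSubsets-removalTerm : ∀ {N} (A : BoolRel (suc N)) j v →
    sumSubsets (suc N) (λ I → removalTerm A j I v) ≡ (if isSource A v then sumSubsets N (idealTerm (removeVertex v A) j) else 0)
  sumSubsets-removalTerm {N} A j v =
    trans (sumSubsets-insertAt N v (λ I → removalTerm A j I v))
      (trans (cong₂ _+_ (sumSubsets-cong N outside) (sumSubsets-zero N inside))
        (trans (ℕP.+-identityʳ _) (sumSubsets-if N (isSource A v) (idealTerm (removeVertex v A) j))))
    where
    term : Vec Bool (suc N) → ℕ
    term I = if idealGuard A j I then orderingsOn A (complement I [ v ]≔ false) * orderingsOn A I else 0
    inside : ∀ I → removalTerm A j (insertAt I v true) v ≡ 0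
    inside I = cong (λ b → if b ∧ isSource A v then term (insertAt I v true) else 0) (lookup-complement-insertAt I v true)
    outside : ∀ I → removalTerm A j (insertAt I v false) v ≡ (if isSource A v then idealTerm (removeVertex v A) j I else 0)
    outside I = trans (cong (λ b → if b ∧ isSource A v then term (insertAt I v false) else 0) (lookup-complement-insertAt I v false))
      (if-congʳ (isSource A v) λ source → cong₂ (if_then_else 0)
        (cong₂ _∧_ (isIdeal-insertAt A v source I) (cong (_≡ᵇ j) (size-insertAt-false I v)))
        (cong₂ _*_ (trans (cong (orderingsOn A) (complement-insertAt I v)) (orderingsOn-insertAt A v (complement I)))
                   (orderingsOn-insertAt A v I)))

  sumSubsets-idealTerm-full : ∀ N (A : BoolRel N) → sumSubsets N (idealTerm A N) ≡ orderings N A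
  sumSubsets-idealTerm-full N A = begin
    sumSubsets N (idealTerm A N)
      ≡⟨ sumSubsets-cong N (λ I → if-∧-swap (does (isIdealOf? A I)) (size I ≡ᵇ N) _) ⟩
    sumSubsets N (λ I → if size I ≡ᵇ N then (if does (isIdealOf? A I) then orderingsOn A (complement I) * orderingsOn A I else 0) else 0)
      ≡⟨ sumSubsets-full N _ ⟩
    (if does (isIdealOf? A all) then orderingsOn A (complement all) * orderingsOn A all else 0)
      ≡⟨ cong (if_then orderingsOn A (complement all) * orderingsOn A all else 0) (dec-true (isIdealOf? A all) (λ _ y _ _ → VP.lookup-replicate y true)) ⟩
    orderingsOn A (complement all) * orderingsOn A all
      ≡⟨ cong₂ _*_ (orderingsOn-empty A (complement all) (size-complement-replicate N)) (orderingsOn-replicate A) ⟩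
    1 * orderings N A
      ≡⟨ ℕP.*-identityˡ _ ⟩
    orderings N A ∎
    where
    open ≡-Reasoning
    all : Vec Bool N
    all = V.replicate N true

  sumSubsets-idealTerm : ∀ N (A : BoolRel N) j → j ≤ N → sumSubsets N (idealTerm A j) ≡ orderings N A
  sumSubsets-idealTerm zero    A .zero z≤n = sumSubsets-idealTerm-full zero A
  sumSubsets-idealTerm (suc N) A j j≤1+N with ℕP.m≤n⇒m<n∨m≡n j≤1+N
  ... | inj₂ refl      = sumSubsets-idealTerm-full (suc N) A
  ... | inj₁ (s≤s j≤N) = begin
    sumSubsets (suc N) (idealTerm A j)
      ≡⟨ sumSubsets-cong (suc N) (idealTerm≡sum-removalTerm A j j≤N) ⟩
    sumSubsets (suc N) (sum ∘ removalTerm A j)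
      ≡⟨ sumSubsets-sum-comm (suc N) (removalTerm A j) ⟩
    sum (λ v → sumSubsets (suc N) (λ I → removalTerm A j I v))
      ≡⟨ Σℕ.sum-cong-≗ (sumSubsets-removalTerm A j) ⟩
    sum (λ v → if isSource A v then sumSubsets N (idealTerm (removeVertex v A) j) else 0)
      ≡⟨ Σℕ.sum-cong-≗ (λ v → cong (if isSource A v then_else 0) (sumSubsets-idealTerm N (removeVertex v A) j j≤N)) ⟩
    orderings (suc N) A ∎
    where open ≡-Reasoning

  ℓG-⊔ : ∀ G H → ℓG (G ⊔G H) ≡ ((n G + n H) C n G) * (ℓG G * ℓG H)
  ℓG-⊔ G H = begin
    ℓG (G ⊔G H)                                                  ≡⟨ ℓG≡orderings (G ⊔G H) ⟩
    orderings (n G + n H) (A G ⊕ A H)                            ≡⟨ orderings-⊕ (n G) (n H) (A G) (A H) ⟩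
    ((n G + n H) C n G) * (orderings (n G) (A G) * orderings (n H) (A H))
      ≡⟨ cong (((n G + n H) C n G) *_) (sym (cong₂ _*_ (ℓG≡orderings G) (ℓG≡orderings H))) ⟩
    ((n G + n H) C n G) * (ℓG G * ℓG H)                          ∎
    where open ≡-Reasoning

  ℓG-≅ : ∀ G H → G ≅ H → ℓG G ≡ ℓG H
  ℓG-≅ G H (σ , h) = trans (ℓG≡orderings G)
    (trans (orderings-relabel {A = A G} {A H} σ (λ x y → proj₂ (h x y))) (sym (ℓG≡orderings H)))

  ℓG-empty : ∀ G → n G ≡ 0 → ℓG G ≡ 1
  ℓG-empty G e = trans (ℓG≡orderings G) (orderings-of-0 (n G) (A G) e)
    where
    orderings-of-0 : ∀ m (B : BoolRel m) → m ≡ 0 → orderings m B ≡ 1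
    orderings-of-0 zero B _ = refl

  ≡ᵇ-+ʳ : ∀ a i j → (a + j ≡ᵇ i + j) ≡ (a ≡ᵇ i)
  ≡ᵇ-+ʳ a i j with a ≡ᵇ i in e
  ... | true  = ≡ᵇ-true (a + j) (i + j) (cong (_+ j) (≡ᵇ-sound a i e))
  ... | false = ≡ᵇ-false (a + j) (i + j) λ a+j≡i+j →
                  false≢true (trans (sym e) (≡ᵇ-true a i (ℕP.+-cancelʳ-≡ j a i a+j≡i+j)))

  size-guard : ∀ a b i j → ((a ≡ᵇ i) ∧ (b ≡ᵇ j)) ≡ ((a + b ≡ᵇ i + j) ∧ (b ≡ᵇ j))
  size-guard a b i j with b ≡ᵇ j in e
  ... | false = trans (BP.∧-zeroʳ _) (sym (BP.∧-zeroʳ _))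
  ... | true  = trans (BP.∧-identityʳ _)
                  (trans (sym (trans (cong (λ k → a + k ≡ᵇ i + j) (≡ᵇ-sound b j e)) (≡ᵇ-+ʳ a i j)))
                         (sym (BP.∧-identityʳ _)))

  listSum-filter : ∀ {a p} {X : Set a} {P : Pred X p} (P? : Decidable P) (g : X → ℕ) xs →
                   listSum (map g (filter P? xs)) ≡ listSum (map (λ x → if does (P? x) then g x else 0) xs)
  listSum-filter P? g []       = refl
  listSum-filter P? g (x ∷ xs) with does (P? x)
  ... | true  = cong (g x +_) (listSum-filter P? g xs)
  ... | false = listSum-filter P? g xs

  ℓG-ideals : ∀ G i j →
    listSum (map (λ I → if (n (G ∖ I) ≡ᵇ i) ∧ (n (G ∣ I) ≡ᵇ j) then ℓG (G ∖ I) * ℓG (G ∣ I) else 0) (ideals G))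
      ≡ (if n G ≡ᵇ i + j then ℓG G else 0)
  ℓG-ideals G i j = begin
    listSum (map term (ideals G))
      ≡⟨ listSum-filter (isIdeal? G) term (allVecs (true ∷ false ∷ []) (n G)) ⟩
    listSum (map (λ I → if does (isIdeal? G I) then term I else 0) (allVecs (true ∷ false ∷ []) (n G)))
      ≡⟨ listSum-allVecs (n G) _ ⟩
    sumSubsets (n G) (λ I → if does (isIdeal? G I) then term I else 0)
      ≡⟨ sumSubsets-cong (n G) (λ I → cong (λ b → if does (isIdeal? G I) then (if b then P I else 0) else 0)
           (trans (size-guard (size (complement I)) (size I) i j)
                  (cong (λ k → (k ≡ᵇ i + j) ∧ (size I ≡ᵇ j)) (size-complement I)))) ⟩
    sumSubsets (n G) (λ I → if does (isIdeal? G I) then (if (n G ≡ᵇ i + j) ∧ (size I ≡ᵇ j) then P I else 0) else 0)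
      ≡⟨ split (n G ≡ᵇ i + j) refl ⟩
    (if n G ≡ᵇ i + j then ℓG G else 0) ∎
    where
    open ≡-Reasoning
    P : Vec Bool (n G) → ℕ
    P I = ℓG (G ∖ I) * ℓG (G ∣ I)
    term : Vec Bool (n G) → ℕ
    term I = if (n (G ∖ I) ≡ᵇ i) ∧ (n (G ∣ I) ≡ᵇ j) then P I else 0
    split : ∀ b → (n G ≡ᵇ i + j) ≡ b →
      sumSubsets (n G) (λ I → if does (isIdeal? G I) then (if b ∧ (size I ≡ᵇ j) then P I else 0) else 0)
        ≡ (if b then ℓG G else 0)
    split false _ = sumSubsets-zero (n G) (λ I → if-zero (does (isIdeal? G I)))
    split true  e = begin
      sumSubsets (n G) (λ I → if does (isIdeal? G I) then (if size I ≡ᵇ j then P I else 0) else 0)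
        ≡⟨ sumSubsets-cong (n G) (λ I → trans (if-∧ (does (isIdeal? G I)) (size I ≡ᵇ j) (P I))
                                               (cong (if idealGuard (A G) j I then_else 0)
                                                     (cong₂ _*_ (ℓG≡orderings (G ∖ I)) (ℓG≡orderings (G ∣ I))))) ⟩
      sumSubsets (n G) (idealTerm (A G) j)
        ≡⟨ sumSubsets-idealTerm (n G) (A G) j j≤n ⟩
      orderings (n G) (A G)
        ≡⟨ sym (ℓG≡orderings G) ⟩
      ℓG G ∎
      where
      j≤n : j ≤ n G
      j≤n = subst (j ≤_) (sym (≡ᵇ-sound (n G) (i + j) e)) (ℕP.m≤n+m j i)

  binomial-factorials : ∀ i j → ((i + j) C i) * (i ! * j !) ≡ (i + j) !
  binomial-factorials i j = begin
    ((i + j) C i) * (i ! * j !)             ≡⟨ cong (λ k → ((i + j) C i) * (i ! * k !)) (sym (ℕP.m+n∸m≡n i j)) ⟩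
    ((i + j) C i) * (i ! * (i + j ∸ i) !)   ≡⟨ cong (_* (i ! * (i + j ∸ i) !)) (nCk≡n!/k![n-k]! (ℕP.m≤m+n i j)) ⟩
    ((i + j) ! ℕ./ (i ! * (i + j ∸ i) !)) * (i ! * (i + j ∸ i) !)
                                           ≡⟨ m/n*n≡m (k![n∸k]!∣n! (ℕP.m≤m+n i j)) ⟩
    (i + j) !                              ∎
    where
    open ≡-Reasoning
    instance _ = i ℕP.!* (i + j ∸ i) !≢0

module Character {c ℓ} (K : CharZeroField c ℓ) where

  open import Data.Nat as ℕ using (ℕ; zero; suc; _!; _≡ᵇ_; _∸_)
  import Data.Nat.Properties as ℕP
  open import Data.Nat.Combinatorics using (_C_)
  open import Data.Nat.ListAction using () renaming (sum to listSum)
  open import Data.Bool using (Bool; true; false; if_then_else_; _∧_)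
  open import Data.Vec using (Vec)
  open import Data.List as List using (List; []; _∷_; map; concatMap)
  import Data.List.Properties as LP
  open import Data.Product using (_,_)
  open import Function using (_∘′_)
  open import Data.Sum using (inj₁; inj₂)
  open import Relation.Nullary using (yes; no)
  open import Relation.Binary.PropositionalEquality as ≡ using (_≡_; _≢_)
  import Data.Fin.Permutation as Perm
  import Algebra.Properties.CommutativeSemigroup as CommSemigroupProps
  open CharZeroField K using (inv; inv-r)
  open Over K hiding (zero)
  open import Relation.Binary.Reasoning.Setoid setoid
  open Counting using (ℓG-⊔; ℓG-≅; ℓG-empty; ℓG-ideals; binomial-factorials; ≡ᵇ-true; ≡ᵇ-false; ≡ᵇ-sound)

  open CommSemigroupProps *-commutativeSemigroup using (interchange; x∙yz≈y∙xz)

  ι-+ : ∀ a b → ιK (a ℕ.+ b) ≈ ιK a + ιK b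
  ι-+ zero    b = sym (+-identityˡ _)
  ι-+ (suc a) b = trans (+-congˡ (ι-+ a b)) (sym (+-assoc _ _ _))

  ι-* : ∀ a b → ιK (a ℕ.* b) ≈ ιK a * ιK b
  ι-* zero    b = sym (zeroˡ _)
  ι-* (suc a) b = begin
    ιK (b ℕ.+ a ℕ.* b)        ≈⟨ ι-+ b (a ℕ.* b) ⟩
    ιK b + ιK (a ℕ.* b)       ≈⟨ +-cong (sym (*-identityˡ _)) (ι-* a b) ⟩
    1# * ιK b + ιK a * ιK b   ≈⟨ sym (distribʳ _ _ _) ⟩
    (1# + ιK a) * ιK b        ∎

  ι-≡ : ∀ {a b} → a ≡ b → ιK a ≈ ιK b
  ι-≡ e = reflexive (≡.cong ιK e)

  1/! : ℕ → Carrier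
  1/! d = inv (ιK (d !)) (fact≉0 d)

  !*1/! : ∀ d → ιK (d !) * 1/! d ≈ 1#
  !*1/! d = inv-r _ (fact≉0 d)

  λ₀-cong : ∀ G {p d} → ℓG G ≡ p → n G ≡ d → λ₀ G ≈ ιK p * 1/! d
  λ₀-cong G ≡.refl ≡.refl = refl

  cross-multiply : ∀ {u v s s′ t t′} → s * s′ ≈ 1# → t * t′ ≈ 1# → u * t ≈ v * s → u * s′ ≈ v * t′
  cross-multiply {u} {v} {s} {s′} {t} {t′} ss′≈1 tt′≈1 ut≈vs = begin
    u * s′                ≈⟨ sym (*-identityʳ _) ⟩
    (u * s′) * 1#         ≈⟨ *-congˡ (sym tt′≈1) ⟩
    (u * s′) * (t * t′)   ≈⟨ interchange _ _ _ _ ⟩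
    (u * t) * (s′ * t′)   ≈⟨ *-congʳ ut≈vs ⟩
    (v * s) * (s′ * t′)   ≈⟨ *-assoc _ _ _ ⟩
    v * (s * (s′ * t′))   ≈⟨ *-congˡ (sym (*-assoc _ _ _)) ⟩
    v * ((s * s′) * t′)   ≈⟨ *-congˡ (*-congʳ ss′≈1) ⟩
    v * (1# * t′)         ≈⟨ *-congˡ (*-identityˡ _) ⟩
    v * t′                ∎

  !*!*1/!*1/! : ∀ i j → ιK (i ! ℕ.* j !) * (1/! i * 1/! j) ≈ 1#
  !*!*1/!*1/! i j = begin
    ιK (i ! ℕ.* j !) * (1/! i * 1/! j)       ≈⟨ *-congʳ (ι-* (i !) (j !)) ⟩
    (ιK (i !) * ιK (j !)) * (1/! i * 1/! j)  ≈⟨ interchange _ _ _ _ ⟩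
    (ιK (i !) * 1/! i) * (ιK (j !) * 1/! j)  ≈⟨ *-cong (!*1/! i) (!*1/! j) ⟩
    1# * 1#                                  ≈⟨ *-identityˡ _ ⟩
    1#                                       ∎

  1/!*1/! : ∀ i j → 1/! i * 1/! j ≈ ιK ((i ℕ.+ j) C i) * 1/! (i ℕ.+ j)
  1/!*1/! i j = trans (sym (*-identityˡ _))
    (cross-multiply (!*!*1/!*1/! i j) (!*1/! (i ℕ.+ j))
      (trans (*-identityˡ _) (trans (ι-≡ (≡.sym (binomial-factorials i j))) (ι-* ((i ℕ.+ j) C i) (i ! ℕ.* j !)))))

  λ₀-≅ : ∀ G H → G ≅ H → λ₀ G ≈ λ₀ H
  λ₀-≅ G H iso@(σ , _) = λ₀-cong G (ℓG-≅ G H iso) (Perm.↔⇒≡ σ)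

  λ₀-empty : ∀ G → n G ≡ 0 → λ₀ G ≈ 1#
  λ₀-empty G e = trans (λ₀-cong G (ℓG-empty G e) e) (!*1/! 0)

  λ₀-⊔ : ∀ G H → λ₀ (G ⊔G H) ≈ λ₀ G * λ₀ H
  λ₀-⊔ G H = begin
    ιK (ℓG (G ⊔G H)) * 1/! (n G ℕ.+ n H)
      ≈⟨ cross-multiply (!*1/! (n G ℕ.+ n H)) (!*!*1/!*1/! (n G) (n H)) cleared ⟩
    ιK (ℓG G ℕ.* ℓG H) * (1/! (n G) * 1/! (n H))
      ≈⟨ *-congʳ (ι-* (ℓG G) (ℓG H)) ⟩
    (ιK (ℓG G) * ιK (ℓG H)) * (1/! (n G) * 1/! (n H))
      ≈⟨ interchange _ _ _ _ ⟩
    λ₀ G * λ₀ H ∎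
    where
    cleared : ιK (ℓG (G ⊔G H)) * ιK (n G ! ℕ.* n H !) ≈ ιK (ℓG G ℕ.* ℓG H) * ιK ((n G ℕ.+ n H) !)
    cleared = begin
      ιK (ℓG (G ⊔G H)) * ιK (n G ! ℕ.* n H !)
        ≈⟨ sym (ι-* (ℓG (G ⊔G H)) _) ⟩
      ιK (ℓG (G ⊔G H) ℕ.* (n G ! ℕ.* n H !))
        ≡⟨ ≡.cong (λ k → ιK (k ℕ.* (n G ! ℕ.* n H !))) (ℓG-⊔ G H) ⟩
      ιK ((((n G ℕ.+ n H) C n G) ℕ.* (ℓG G ℕ.* ℓG H)) ℕ.* (n G ! ℕ.* n H !))
        ≡⟨ ≡.cong ιK (rearrange ((n G ℕ.+ n H) C n G) (ℓG G ℕ.* ℓG H) (n G ! ℕ.* n H !)) ⟩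
      ιK ((ℓG G ℕ.* ℓG H) ℕ.* (((n G ℕ.+ n H) C n G) ℕ.* (n G ! ℕ.* n H !)))
        ≡⟨ ≡.cong (λ k → ιK ((ℓG G ℕ.* ℓG H) ℕ.* k)) (binomial-factorials (n G) (n H)) ⟩
      ιK ((ℓG G ℕ.* ℓG H) ℕ.* (n G ℕ.+ n H) !)
        ≈⟨ ι-* (ℓG G ℕ.* ℓG H) _ ⟩
      ιK (ℓG G ℕ.* ℓG H) * ιK ((n G ℕ.+ n H) !) ∎
      where
      rearrange : ∀ a b d → (a ℕ.* b) ℕ.* d ≡ b ℕ.* (a ℕ.* d)
      rearrange a b d = ≡.trans (≡.cong (ℕ._* d) (ℕP.*-comm a b)) (ℕP.*-assoc b a d)

  sumK-cong : ∀ {a} {X : Set a} {f g : X → Carrier} xs → (∀ x → f x ≈ g x) → sumK (map f xs) ≈ sumK (map g xs)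
  sumK-cong []       h = refl
  sumK-cong (x ∷ xs) h = +-cong (h x) (sumK-cong xs h)

  sumK-++ : ∀ xs ys → sumK (xs List.++ ys) ≈ sumK xs + sumK ys
  sumK-++ []       ys = sym (+-identityˡ _)
  sumK-++ (x ∷ xs) ys = trans (+-congˡ (sumK-++ xs ys)) (sym (+-assoc _ _ _))

  sumK-concatMap : ∀ {a b} {X : Set a} {Y : Set b} (f : Y → Carrier) (g : X → List Y) xs →
                   sumK (map f (concatMap g xs)) ≈ sumK (map (λ x → sumK (map f (g x))) xs)
  sumK-concatMap f g []       = refl
  sumK-concatMap f g (x ∷ xs) = begin
    sumK (map f (g x List.++ concatMap g xs))           ≡⟨ ≡.cong sumK (LP.map-++ f (g x) (concatMap g xs)) ⟩
    sumK (map f (g x) List.++ map f (concatMap g xs))   ≈⟨ sumK-++ (map f (g x)) _ ⟩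
    sumK (map f (g x)) + sumK (map f (concatMap g xs))  ≈⟨ +-congˡ (sumK-concatMap f g xs) ⟩
    sumK (map (λ x → sumK (map f (g x))) (x ∷ xs))      ∎

  sumK-map-∘ : ∀ {a b} {X : Set a} {Y : Set b} (f : Y → Carrier) (g : X → Y) xs → sumK (map f (map g xs)) ≈ sumK (map (f ∘′ g) xs)
  sumK-map-∘ f g xs = reflexive (≡.cong sumK (≡.sym (LP.map-∘ xs)))

  sumK-*ˡ : ∀ {a} {X : Set a} (k : Carrier) (f : X → Carrier) xs → sumK (map (λ x → k * f x) xs) ≈ k * sumK (map f xs)
  sumK-*ˡ k f []       = sym (zeroʳ k)
  sumK-*ˡ k f (x ∷ xs) = trans (+-congˡ (sumK-*ˡ k f xs)) (sym (distribˡ _ _ _))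

  sumK-ι : ∀ {a} {X : Set a} (g : X → ℕ) xs → sumK (map (ιK ∘′ g) xs) ≈ ιK (listSum (map g xs))
  sumK-ι g []       = refl
  sumK-ι g (x ∷ xs) = trans (+-congˡ (sumK-ι g xs)) (sym (ι-+ (g x) _))

  sumTo-+ : ∀ k f g → sumTo k (λ i → f i + g i) ≈ sumTo k f + sumTo k g
  sumTo-+ zero    f g = refl
  sumTo-+ (suc k) f g = trans (+-congʳ (sumTo-+ k f g)) (CommSemigroupProps.interchange +-commutativeSemigroup _ _ _ _)

  sumTo-zero : ∀ k f → (∀ i → i ℕ.≤ k → f i ≈ 0#) → sumTo k f ≈ 0#
  sumTo-zero zero    f h = h 0 ℕ.z≤n
  sumTo-zero (suc k) f h =
    trans (+-cong (sumTo-zero k f (λ i i≤k → h i (ℕP.m≤n⇒m≤1+n i≤k))) (h (suc k) ℕP.≤-refl)) (+-identityʳ _)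

  sumTo-delta : ∀ k p f → p ℕ.≤ k → (∀ i → i ≢ p → f i ≈ 0#) → sumTo k f ≈ f p
  sumTo-delta zero    .zero f ℕ.z≤n others = refl
  sumTo-delta (suc k) p     f p≤1+k others with ℕP.m≤n⇒m<n∨m≡n p≤1+k
  ... | inj₂ ≡.refl        =
    trans (+-congʳ (sumTo-zero k f (λ i i≤k → others i (λ e → ℕP.<-irrefl e (ℕ.s≤s i≤k))))) (+-identityˡ _)
  ... | inj₁ (ℕ.s≤s p≤k) =
    trans (+-cong (sumTo-delta k p f p≤k others) (others (suc k) (λ e → ℕP.<-irrefl (≡.sym e) (ℕ.s≤s p≤k)))) (+-identityʳ _)

  sumTo-sumK : ∀ {a} {X : Set a} k (h : ℕ → X → Carrier) xs →
               sumTo k (λ i → sumK (map (h i) xs)) ≈ sumK (map (λ x → sumTo k (λ i → h i x)) xs)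
  sumTo-sumK k h []       = sumTo-zero k _ (λ _ _ → refl)
  sumTo-sumK k h (x ∷ xs) = trans (sumTo-+ k (λ i → h i x) (λ i → sumK (map (h i) xs))) (+-congˡ (sumTo-sumK k h xs))

  -- the pairs (i , k ∸ i) with i ≤ k are exactly the splittings of k
  sumTo-splitting : ∀ k p q X → sumTo k (λ i → if (p ≡ᵇ i) ∧ (q ≡ᵇ k ∸ i) then X else 0#) ≈ (if p ℕ.+ q ≡ᵇ k then X else 0#)
  sumTo-splitting k p q X with p ℕP.≤? k
  ... | yes p≤k = trans (sumTo-delta k p _ p≤k (λ i i≢p → reflexive (≡.cong (λ b → if b ∧ (q ≡ᵇ k ∸ i) then X else 0#)
                                                                        (≡ᵇ-false p i (i≢p ∘′ ≡.sym)))))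
                        (reflexive (≡.cong₂ (λ b b′ → if b ∧ b′ then X else 0#) (≡ᵇ-true p p ≡.refl) q≡k∸p⇔))
    where
    q≡k∸p⇔ : (q ≡ᵇ k ∸ p) ≡ (p ℕ.+ q ≡ᵇ k)
    q≡k∸p⇔ with q ≡ᵇ k ∸ p in e
    ... | true  = ≡.sym (≡ᵇ-true (p ℕ.+ q) k (≡.trans (≡.cong (p ℕ.+_) (≡ᵇ-sound q (k ∸ p) e)) (ℕP.m+[n∸m]≡n p≤k)))
    ... | false = ≡.sym (≡ᵇ-false (p ℕ.+ q) k λ p+q≡k → Counting.false≢true (≡.trans (≡.sym e)
                    (≡ᵇ-true q (k ∸ p) (≡.trans (≡.sym (ℕP.m+n∸m≡n p q)) (≡.cong (ℕ._∸ p) p+q≡k)))))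
  ... | no p≰k = trans (sumTo-zero k _ (λ i i≤k → reflexive (≡.cong (λ b → if b ∧ (q ≡ᵇ k ∸ i) then X else 0#)
                                           (≡ᵇ-false p i (λ p≡i → p≰k (≡.subst (ℕ._≤ k) (≡.sym p≡i) i≤k))))))
                       (reflexive (≡.sym (≡.cong (if_then X else 0#)
                                           (≡ᵇ-false (p ℕ.+ q) k (λ p+q≡k → p≰k (≡.subst (p ℕ.≤_) p+q≡k (ℕP.m≤m+n p q)))))))

  if-≈ : ∀ b {X Y} → X ≈ Y → (if b then X else 0#) ≈ (if b then Y else 0#)
  if-≈ true  X≈Y = X≈Y
  if-≈ false _   = refl

  λ₀F-unit : λ₀F 1F ≈ 1#
  λ₀F-unit = trans (+-identityʳ _) (trans (*-identityˡ _) (λ₀-empty ∅G ≡.refl))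

  λ₀F-mF : ∀ z → λ₀F (mF z) ≈ λ₀⊗λ₀ z
  λ₀F-mF z = trans (sumK-map-∘ _ _ z) (sumK-cong z λ { (a , G , H) → *-congˡ (λ₀-⊔ G H) })

  φ₀-unit : φ₀ 1F ≈P 1P
  φ₀-unit zero    = λ₀F-unit
  φ₀-unit (suc k) = +-identityʳ _

  φ₀-mF : ∀ z → φ₀ (mF z) ≈P mP (φ₀⊗φ₀ z)
  φ₀-mF z k = begin
    φ₀ (mF z) k
      ≈⟨ sumK-map-∘ _ _ z ⟩
    sumK (map (λ { (a , G , H) → if n G ℕ.+ n H ≡ᵇ k then a * λ₀ (G ⊔G H) else 0# }) z)
      ≈⟨ sumK-cong z (λ { (a , G , H) → trans (if-≈ (n G ℕ.+ n H ≡ᵇ k) (*-congˡ (λ₀-⊔ G H)))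
                                               (sym (sumTo-splitting k (n G) (n H) (a * (λ₀ G * λ₀ H)))) }) ⟩
    sumK (map (λ { (a , G , H) → sumTo k (λ i → if (n G ≡ᵇ i) ∧ (n H ≡ᵇ k ∸ i) then a * (λ₀ G * λ₀ H) else 0#) }) z)
      ≈⟨ sym (sumTo-sumK k _ z) ⟩
    mP (φ₀⊗φ₀ z) k ∎

  φ₀-counit : ∀ x → εP (φ₀ x) ≈ εF x
  φ₀-counit x = sumK-cong x λ { (a , G) → term a G }
    where
    term : ∀ a G → (if n G ≡ᵇ 0 then a * λ₀ G else 0#) ≈ (if n G ≡ᵇ 0 then a else 0#)
    term a G with n G ≡ᵇ 0 in e
    ... | true  = trans (*-congˡ (λ₀-empty G (≡ᵇ-sound (n G) 0 e))) (*-identityʳ _)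
    ... | false = refl

  -- λ₀(G ∖ I) λ₀(G ∣ I) = ℓ(G ∖ I) ℓ(G ∣ I) / (i! j!), and the ideal sum of the numerators is ℓ(G)
  sum-ideals-λ₀ : ∀ i j a G →
    sumK (map (λ I → if (n (G ∖ I) ≡ᵇ i) ∧ (n (G ∣ I) ≡ᵇ j) then a * (λ₀ (G ∖ I) * λ₀ (G ∣ I)) else 0#) (ideals G))
      ≈ ιK ((i ℕ.+ j) C i) * (if n G ≡ᵇ i ℕ.+ j then a * λ₀ G else 0#)
  sum-ideals-λ₀ i j a G = begin
    sumK (map (λ I → if guard I then a * (λ₀ (G ∖ I) * λ₀ (G ∣ I)) else 0#) (ideals G))
      ≈⟨ sumK-cong (ideals G) summand ⟩
    sumK (map (λ I → (a * D) * ιK (numerator I)) (ideals G))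
      ≈⟨ sumK-*ˡ (a * D) (ιK ∘′ numerator) (ideals G) ⟩
    (a * D) * sumK (map (ιK ∘′ numerator) (ideals G))
      ≈⟨ *-congˡ (sumK-ι numerator (ideals G)) ⟩
    (a * D) * ιK (listSum (map numerator (ideals G)))
      ≈⟨ *-congˡ (ι-≡ (ℓG-ideals G i j)) ⟩
    (a * D) * ιK (if n G ≡ᵇ i ℕ.+ j then ℓG G else 0)
      ≈⟨ total ⟩
    ιK ((i ℕ.+ j) C i) * (if n G ≡ᵇ i ℕ.+ j then a * λ₀ G else 0#) ∎
    where
    D : Carrier
    D = 1/! i * 1/! j
    guard : Vec Bool (n G) → Bool
    guard I = (n (G ∖ I) ≡ᵇ i) ∧ (n (G ∣ I) ≡ᵇ j)
    numerator : Vec Bool (n G) → ℕ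
    numerator I = if guard I then ℓG (G ∖ I) ℕ.* ℓG (G ∣ I) else 0
    summand : ∀ I → (if guard I then a * (λ₀ (G ∖ I) * λ₀ (G ∣ I)) else 0#) ≈ (a * D) * ιK (numerator I)
    summand I with n (G ∖ I) ≡ᵇ i in e₁ | n (G ∣ I) ≡ᵇ j in e₂
    ... | true  | true  = begin
      a * (λ₀ (G ∖ I) * λ₀ (G ∣ I))
        ≈⟨ *-congˡ (*-cong (λ₀-cong (G ∖ I) ≡.refl (≡ᵇ-sound _ _ e₁)) (λ₀-cong (G ∣ I) ≡.refl (≡ᵇ-sound _ _ e₂))) ⟩
      a * ((ιK (ℓG (G ∖ I)) * 1/! i) * (ιK (ℓG (G ∣ I)) * 1/! j))
        ≈⟨ *-congˡ (trans (interchange _ _ _ _) (*-congʳ (sym (ι-* (ℓG (G ∖ I)) (ℓG (G ∣ I)))))) ⟩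
      a * (ιK (ℓG (G ∖ I) ℕ.* ℓG (G ∣ I)) * D)
        ≈⟨ trans (*-congˡ (*-comm _ _)) (sym (*-assoc _ _ _)) ⟩
      (a * D) * ιK (ℓG (G ∖ I) ℕ.* ℓG (G ∣ I)) ∎
    ... | true  | false = sym (zeroʳ _)
    ... | false | _     = sym (zeroʳ _)
    total : (a * D) * ιK (if n G ≡ᵇ i ℕ.+ j then ℓG G else 0) ≈ ιK ((i ℕ.+ j) C i) * (if n G ≡ᵇ i ℕ.+ j then a * λ₀ G else 0#)
    total with n G ≡ᵇ i ℕ.+ j in e
    ... | false = trans (zeroʳ _) (sym (zeroʳ _))
    ... | true  = begin
      (a * D) * ιK (ℓG G)                                  ≈⟨ *-congʳ (*-congˡ (1/!*1/! i j)) ⟩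
      (a * (binom * 1/! (i ℕ.+ j))) * ιK (ℓG G)                ≈⟨ *-assoc _ _ _ ⟩
      a * ((binom * 1/! (i ℕ.+ j)) * ιK (ℓG G))                ≈⟨ *-congˡ (trans (*-assoc _ _ _) (*-congˡ (*-comm _ _))) ⟩
      a * (binom * (ιK (ℓG G) * 1/! (i ℕ.+ j)))                ≈⟨ x∙yz≈y∙xz a binom _ ⟩
      binom * (a * (ιK (ℓG G) * 1/! (i ℕ.+ j)))                ≈⟨ *-congˡ (*-congˡ (sym (λ₀-cong G ≡.refl (≡ᵇ-sound _ _ e)))) ⟩
      binom * (a * λ₀ G)                                       ∎
      where
      binom : Carrier
      binom = ιK ((i ℕ.+ j) C i)

  φ₀-Δ : ∀ x → φ₀⊗φ₀ (ΔF x) ≈P² ΔP (φ₀ x)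
  φ₀-Δ x i j = begin
    φ₀⊗φ₀ (ΔF x) i j
      ≈⟨ sumK-concatMap _ _ x ⟩
    sumK (map (λ { (a , G) → sumK (map _ (map (λ I → (a , G ∖ I , G ∣ I)) (ideals G))) }) x)
      ≈⟨ sumK-cong x (λ { (a , G) → trans (sumK-map-∘ _ _ (ideals G)) (sum-ideals-λ₀ i j a G) }) ⟩
    sumK (map (λ { (a , G) → ιK ((i ℕ.+ j) C i) * (if n G ≡ᵇ i ℕ.+ j then a * λ₀ G else 0#) }) x)
      ≈⟨ sumK-*ˡ _ _ x ⟩
    ΔP (φ₀ x) i j ∎

open import Data.Product using (_×_; _,_)

corollary3p5 : ∀ {c ℓ} (K : CharZeroField c ℓ) → let open Over K in
    -- λ₀ is well defined on isomorphism classes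
    (∀ G H → G ≅ H → λ₀ G ≈ λ₀ H)
    -- λ₀ : F[G] → K is an algebra morphism (character)
    × (λ₀F 1F ≈ 1#)
    × (∀ z → λ₀F (mF z) ≈ λ₀⊗λ₀ z)
    -- φ₀ is an algebra morphism
    × (φ₀ 1F ≈P 1P)
    × (∀ z → φ₀ (mF z) ≈P mP (φ₀⊗φ₀ z))
    -- φ₀ is a coalgebra morphism
    × (∀ x → φ₀⊗φ₀ (ΔF x) ≈P² ΔP (φ₀ x))
    × (∀ x → εP (φ₀ x) ≈ εF x)
corollary3p5 K = λ₀-≅ , λ₀F-unit , λ₀F-mF , φ₀-unit , φ₀-mF , φ₀-Δ , φ₀-counit
  where open Character K
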